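{- Let $r\ge 1$, $k\ge 1$, $n = rk+1$, and fix an $r$-perfect matching $M$ of $[rk]$. Then there is a bijection between the set of $(r+1)$-spanning trees $T$ on the vertex set $[n]$ with $\mu(T)=M$ (the $(r+1)$-spanning trees arising from $M$) and the set $\mathsf{Park}_k^r$ of $r$-parking functions of length $k$. In particular these two sets have the same cardinality.
   Context: For $s\ge 2$, an $s$-spanning tree on a vertex set $V$ is a set $E$ of $s$-element subsets of $V$ (hyperedges) such that the bipartite incidence graph (vertex classes $V$ and $E$, a hyperedge adjacent exactly to the vertices it contains) is a tree. An $r$-perfect matching of a set $W$ is a partition of $W$ into blocks of size $r$. For an $(r+1)$-spanning tree $T$ on $[rk+1]$, the $r$-perfect matching $\mu(T)$ of $[rk]$ it arises from is obtained as follows: delete vertex $n=rk+1$ from every hyperedge of $T$; each hyperedge that now has size $r$ becomes a block of $\mu(T)$, and its vertices are called matched. Then repeatedly delete all matched vertices from the remaining (not yet used) hyperedges of size $r+1$; each such hyperedge that drops to size $r$ becomes a block of $\mu(T)$ and its vertices become matched. This terminates with an $r$-perfect matching $\mu(T)$ of $[rk]$, having the property that each hyperedge of $T$ contains exactly one block of $\mu(T)$. A sequence $(a_1,\dots,a_k)\in\mathbb{Z}_{\ge 0}^k$ is an $r$-parking function of length $k$ if its weakly increasing rearrangement $b_1\le \dots\le b_k$ satisfies $b_i \le r(i-1)$ for all $i$; $\mathsf{Park}_k^r$ denotes the set of these. -}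

module Defs where

open import Level using (0ℓ)
open import Data.Nat using (ℕ; zero; suc; _+_; _*_; _≤_; _≟_)
open import Data.Bool using (Bool; true; false; if_then_else_)
open import Data.Fin as Fin using (Fin; toℕ; fromℕ)
open import Data.Fin.Subset using (Subset; _∈_; _∉_; ∣_∣; _∩_; _∪_; _─_; _-_; ⋃; ⊥)
open import Data.Fin.Subset.Properties using (_∈?_)
open import Data.Vec using (Vec; init; toList)
open import Data.List using (List; []; _∷_; length; lookup; map; filter; partition)
open import Data.List.Relation.Unary.All using (All)
open import Data.List.Relation.Unary.Unique.Propositional using (Unique)
open import Data.List.Relation.Unary.Linked using (Linked)
open import Data.List.Relation.Unary.Sorted.TotalOrder using (Sorted)
open import Data.List.Relation.Binary.Permutation.Propositional using (_↭_; ↭-refl; ↭-sym; ↭-trans)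
import Data.List.Membership.Propositional as Mem
open import Data.Sum using (_⊎_; inj₁; inj₂)
open import Data.Product using (Σ; ∃; ∃-syntax; _×_; _,_; proj₁; proj₂)
open import Data.Empty renaming (⊥ to Empty)
open import Relation.Nullary using (¬_; yes; no)
open import Relation.Binary.Bundles using (Setoid)
open import Relation.Binary.PropositionalEquality using (_≡_; refl; sym; trans; isEquivalence)
open import Relation.Binary.Construct.Closure.ReflexiveTransitive using (Star)
import Data.Nat.Properties as ℕP

-- A hyperedge is a subset of the
-- vertex set (Data.Fin.Subset); a set of hyperedges is a duplicate-free
-- list of subsets (its order is irrelevant: we compare such lists up to
-- permutation).

-- Nodes of the bipartite incidence graph of E: vertices (inj₁) and
-- hyperedges, identified by their position in the list E (inj₂).
Node : (n : ℕ) → List (Subset n) → Set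
Node n E = Fin n ⊎ Fin (length E)

Adj : {n : ℕ} (E : List (Subset n)) → Node n E → Node n E → Set
Adj E (inj₁ v) (inj₁ w) = Empty
Adj E (inj₁ v) (inj₂ j) = v ∈ lookup E j
Adj E (inj₂ i) (inj₁ w) = w ∈ lookup E i
Adj E (inj₂ i) (inj₂ j) = Empty

Connected : {n : ℕ} (E : List (Subset n)) → Set
Connected {n} E = (x y : Node n E) → Star (Adj E) x y

IsCycle : {n : ℕ} (E : List (Subset n)) → List (Node n E) → Set
IsCycle E [] = Empty
IsCycle E (x ∷ []) = Empty
IsCycle E (x ∷ y ∷ []) = Empty
IsCycle E (x ∷ y ∷ z ∷ zs) =
  Unique (x ∷ y ∷ z ∷ zs) × Linked (Adj E) (x ∷ y ∷ z ∷ zs) × Adj E (lastOf z zs) x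
  where
  lastOf : Node _ E → List (Node _ E) → Node _ E
  lastOf a [] = a
  lastOf a (b ∷ bs) = lastOf b bs

Acyclic : {n : ℕ} (E : List (Subset n)) → Set
Acyclic {n} E = (c : List (Node n E)) → ¬ IsCycle E c

IncidenceTree : {n : ℕ} (E : List (Subset n)) → Set
IncidenceTree E = Connected E × Acyclic E

IsSpanningTree : (s n : ℕ) → List (Subset n) → Set
IsSpanningTree s n E = Unique E × All (λ e → ∣ e ∣ ≡ s) E × IncidenceTree E

IsPerfectMatching : (r m : ℕ) → List (Subset m) → Set
IsPerfectMatching r m M =
  All (λ b → ∣ b ∣ ≡ r) M ×
  ((i : Fin m) → Σ (Fin (length M)) λ j →
      i ∈ lookup M j × ((j' : Fin (length M)) → i ∈ lookup M j' → j' ≡ j))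

_≋_ : {A : Set} → List A → List A → Set
xs ≋ ys = ∀ b → (b Mem.∈ xs → b Mem.∈ ys) × (b Mem.∈ ys → b Mem.∈ xs)

-- The matching μ(T) of an (r+1)-spanning tree T on [rk+1] = Fin (suc m),
-- m = rk.  The special vertex n = rk+1 is  fromℕ m  (the last element).

module _ {m : ℕ} where

  private
    N = suc m
    special : Fin N
    special = fromℕ m

  oneMatched : Subset N → Subset N → Bool
  oneMatched S e with ∣ e ∩ S ∣ ≟ 1
  ... | yes _ = true
  ... | no  _ = false

  containsSpecial : Subset N → Bool
  containsSpecial e with special ∈? e
  ... | yes _ = true
  ... | no  _ = false

  -- State: (matched vertices, unused hyperedges, blocks so far).
  round : Subset N × List (Subset N) × List (Subset N) →
          Subset N × List (Subset N) × List (Subset N)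
  round (S , R , B) =
    let P   = partition (λ e → Data.Bool.T? (oneMatched S e)) R
        new = map (λ e → e ─ S) (proj₁ P)
    in (S ∪ ⋃ new , proj₂ P , B Data.List.++ new)
    where import Data.Bool

  iterate : ℕ → Subset N × List (Subset N) × List (Subset N) →
            Subset N × List (Subset N) × List (Subset N)
  iterate zero    st = st
  iterate (suc f) st = iterate f (round st)

  -- μ(T) as a list of blocks of [rk] (drop the last coordinate, which
  -- corresponds to the special vertex and is never in a block).  Then |T| rounds suffice, since
  -- every productive round uses up at least one hyperedge and an
  -- unproductive round is a fixed point.
  μ : List (Subset N) → List (Subset m)
  μ T =
    let P  = partition (λ e → Data.Bool.T? (containsSpecial e)) T
        B₀ = map (λ e → e - special) (proj₁ P)
        fin = iterate (length T) (⋃ B₀ , proj₂ P , B₀)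
    in map init (proj₂ (proj₂ fin))
    where import Data.Bool

TreeFrom : (r k : ℕ) → List (Subset (r * k)) → Set
TreeFrom r k M =
  Σ (List (Subset (suc (r * k)))) λ T →
    IsSpanningTree (suc r) (suc (r * k)) T × μ T ≋ M

TreeFromSetoid : (r k : ℕ) → List (Subset (r * k)) → Setoid 0ℓ 0ℓ
TreeFromSetoid r k M = record
  { Carrier = TreeFrom r k M
  ; _≈_ = λ a b → proj₁ a ↭ proj₁ b
  ; isEquivalence = record
      { refl = ↭-refl ; sym = ↭-sym ; trans = ↭-trans } }

-- r-parking functions of length k: (a₁,…,aₖ) whose weakly increasing
-- rearrangement b₁ ≤ … ≤ bₖ satisfies bᵢ ≤ r(i-1) (0-indexed: b[i] ≤ r·i).

IsParkingFunction : (r k : ℕ) → Vec ℕ k → Set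
IsParkingFunction r k a =
  Σ (List ℕ) λ b →
    b ↭ toList a × Sorted ℕP.≤-totalOrder b ×
    ((i : Fin (length b)) → lookup b i ≤ r * toℕ i)

Park : (r k : ℕ) → Set
Park r k = Σ (Vec ℕ k) (IsParkingFunction r k)

ParkSetoid : (r k : ℕ) → Setoid 0ℓ 0ℓ
ParkSetoid r k = record
  { Carrier = Park r k
  ; _≈_ = λ a b → proj₁ a ≡ proj₁ b
  ; isEquivalence = record { refl = refl ; sym = sym ; trans = trans } }

module Submission where

-- A tree T arising from M contains, for each block B of M, exactly one hyperedge B ∪ {v}: the extra vertex v,
-- the parent of B, is the special vertex n or a vertex of another block. The round in which μ finds B is its
-- depth in this forest of blocks, so the parents form an acyclic assignment, and every acyclic assignment
-- comes from exactly one tree arising from M (up to the order of its hyperedges).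
-- Rank the blocks breadth first (by depth, then by index) and give B the value 0 if its parent is n, and
-- 1 + r · (rank of the parent's block) + (position of the parent in its block) otherwise. A block of depth
-- d + 1 then has value at most r · #(blocks of depth ≤ d), which yields the parking condition. Conversely the
-- depths are recovered from the values through the thresholds t₀ = 0, t_{d+1} = r · #{i : aᵢ ≤ t_d}, and then
-- the parents by division by r.

open import Defs
open import Data.Nat using (ℕ; suc; _*_; _≤_)
open import Data.Nat.Properties using (*-cancelˡ-≡)
open import Data.Fin.Subset using (Subset)
open import Data.List using (List; length)
open import Function.Bundles using (Bijection)
open import Relation.Binary.PropositionalEquality using (_≡_; subst)


module Counting where

  open import Data.Nat using (ℕ; zero; suc; _+_; _≤_; _<_; z≤n; s≤s)
  open import Data.Nat.Properties using (m≤n⇒m≤1+n; +-suc)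
  open import Data.Fin using (Fin; zero; suc)
  open import Data.Fin.Properties using (_≟_; suc-injective)
  open import Data.Product using (∃; _,_)
  open import Data.Empty using (⊥; ⊥-elim)
  open import Relation.Nullary using (Dec; yes; no; ¬_)
  open import Relation.Nullary.Decidable using (_⊎-dec_)
  open import Relation.Binary.PropositionalEquality using (_≡_; refl; cong; sym; trans)
  open import Function using (_∘_)

  sucIf : ∀ {a} {A : Set a} → Dec A → ℕ → ℕ
  sucIf (yes _) c = suc c
  sucIf (no _)  c = c

  count : ∀ {n} {P : Fin n → Set} → (∀ i → Dec (P i)) → ℕ
  count {zero}  P? = 0
  count {suc n} P? = sucIf (P? zero) (count (P? ∘ suc))

  count-cong : ∀ {n} {P Q : Fin n → Set} (P? : ∀ i → Dec (P i)) (Q? : ∀ i → Dec (Q i)) →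
               (∀ i → P i → Q i) → (∀ i → Q i → P i) → count P? ≡ count Q?
  count-cong {zero}  P? Q? P⇒Q Q⇒P = refl
  count-cong {suc n} P? Q? P⇒Q Q⇒P with P? zero | Q? zero
  ... | yes _ | yes _ = cong suc (count-cong (P? ∘ suc) (Q? ∘ suc) (P⇒Q ∘ suc) (Q⇒P ∘ suc))
  ... | yes p | no ¬q = ⊥-elim (¬q (P⇒Q zero p))
  ... | no ¬p | yes q = ⊥-elim (¬p (Q⇒P zero q))
  ... | no _  | no _  = count-cong (P? ∘ suc) (Q? ∘ suc) (P⇒Q ∘ suc) (Q⇒P ∘ suc)

  count-mono : ∀ {n} {P Q : Fin n → Set} (P? : ∀ i → Dec (P i)) (Q? : ∀ i → Dec (Q i)) →
               (∀ i → P i → Q i) → count P? ≤ count Q?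
  count-mono {zero}  P? Q? P⇒Q = z≤n
  count-mono {suc n} P? Q? P⇒Q with P? zero | Q? zero
  ... | yes _ | yes _ = s≤s (count-mono (P? ∘ suc) (Q? ∘ suc) (P⇒Q ∘ suc))
  ... | yes p | no ¬q = ⊥-elim (¬q (P⇒Q zero p))
  ... | no _  | yes _ = m≤n⇒m≤1+n (count-mono (P? ∘ suc) (Q? ∘ suc) (P⇒Q ∘ suc))
  ... | no _  | no _  = count-mono (P? ∘ suc) (Q? ∘ suc) (P⇒Q ∘ suc)

  count-mono-< : ∀ {n} {P Q : Fin n → Set} (P? : ∀ i → Dec (P i)) (Q? : ∀ i → Dec (Q i)) →
                 (∀ i → P i → Q i) → (j : Fin n) → Q j → ¬ P j → count P? < count Q?
  count-mono-< {suc n} P? Q? P⇒Q zero qj ¬pj with P? zero | Q? zero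
  ... | yes p | _     = ⊥-elim (¬pj p)
  ... | no _  | no ¬q = ⊥-elim (¬q qj)
  ... | no _  | yes _ = s≤s (count-mono (P? ∘ suc) (Q? ∘ suc) (P⇒Q ∘ suc))
  count-mono-< {suc n} P? Q? P⇒Q (suc j) qj ¬pj with P? zero | Q? zero
  ... | yes _ | yes _ = s≤s (count-mono-< (P? ∘ suc) (Q? ∘ suc) (P⇒Q ∘ suc) j qj ¬pj)
  ... | yes p | no ¬q = ⊥-elim (¬q (P⇒Q zero p))
  ... | no _  | yes _ = m≤n⇒m≤1+n (count-mono-< (P? ∘ suc) (Q? ∘ suc) (P⇒Q ∘ suc) j qj ¬pj)
  ... | no _  | no _  = count-mono-< (P? ∘ suc) (Q? ∘ suc) (P⇒Q ∘ suc) j qj ¬pj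

  count≤n : ∀ {n} {P : Fin n → Set} (P? : ∀ i → Dec (P i)) → count P? ≤ n
  count≤n {zero}  P? = z≤n
  count≤n {suc n} P? with P? zero
  ... | yes _ = s≤s (count≤n (P? ∘ suc))
  ... | no _  = m≤n⇒m≤1+n (count≤n (P? ∘ suc))

  count<n : ∀ {n} {P : Fin n → Set} (P? : ∀ i → Dec (P i)) (j : Fin n) → ¬ P j → count P? < n
  count<n {suc n} P? zero ¬pj with P? zero
  ... | yes p = ⊥-elim (¬pj p)
  ... | no _  = s≤s (count≤n (P? ∘ suc))
  count<n {suc n} P? (suc j) ¬pj with P? zero
  ... | yes _ = s≤s (count<n (P? ∘ suc) j ¬pj)
  ... | no _  = m≤n⇒m≤1+n (count<n (P? ∘ suc) j ¬pj)

  count≡0 : ∀ {n} {P : Fin n → Set} (P? : ∀ i → Dec (P i)) → (∀ i → ¬ P i) → count P? ≡ 0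
  count≡0 {zero}  P? ¬P = refl
  count≡0 {suc n} P? ¬P with P? zero
  ... | yes p = ⊥-elim (¬P zero p)
  ... | no _  = count≡0 (P? ∘ suc) (¬P ∘ suc)

  count>0⇒∃ : ∀ {n} {P : Fin n → Set} (P? : ∀ i → Dec (P i)) → 0 < count P? → ∃ P
  count>0⇒∃ {suc n} P? pos with P? zero
  ... | yes p = zero , p
  ... | no _  with j , pj ← count>0⇒∃ (P? ∘ suc) pos = suc j , pj

  count-⊎ : ∀ {n} {P Q : Fin n → Set} (P? : ∀ i → Dec (P i)) (Q? : ∀ i → Dec (Q i)) →
            (∀ i → P i → Q i → ⊥) → count (λ i → P? i ⊎-dec Q? i) ≡ count P? + count Q?
  count-⊎ {zero}  P? Q? disjoint = refl
  count-⊎ {suc n} P? Q? disjoint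
    with P? zero | Q? zero | count-⊎ (P? ∘ suc) (Q? ∘ suc) (disjoint ∘ suc)
  ... | yes p | yes q | _  = ⊥-elim (disjoint zero p q)
  ... | yes _ | no _  | ih = cong suc ih
  ... | no _  | yes _ | ih = trans (cong suc ih) (sym (+-suc _ _))
  ... | no _  | no _  | ih = ih

  count-≡ : ∀ {n} (j : Fin n) → count (_≟ j) ≡ 1
  count-≡ {suc n} zero with zero ≟ zero {n}
  ... | yes _ = cong suc (count≡0 (λ i → suc i ≟ zero {n}) (λ i ()))
  ... | no ¬p = ⊥-elim (¬p refl)
  count-≡ {suc n} (suc j) with zero ≟ suc j
  ... | no _ = trans (count-cong (λ i → suc i ≟ suc j) (_≟ j) (λ i → suc-injective) (λ i → cong suc))
                     (count-≡ j)


module LeastSearch where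

  open import Data.Nat using (ℕ; zero; suc; _≤_; _<_; z≤n; s≤s⁻¹; _≤?_; _<?_)
  open import Data.Nat.Properties using (≤-refl; ≤-antisym; m≤n⇒m≤1+n; ≰⇒>; ≮⇒≥; <⇒≱; <-cmp)
  open import Data.Sum using (_⊎_; inj₁; inj₂)
  open import Data.Empty using (⊥-elim)
  open import Relation.Nullary using (Dec; yes; no; ¬_)
  open import Relation.Binary.PropositionalEquality using (_≡_; refl; sym; trans; subst)
  open import Relation.Binary.Definitions using (tri<; tri≈; tri>)

  -- The least m ≤ n satisfying P, or n if there is none.
  least : {P : ℕ → Set} → (∀ m → Dec (P m)) → ℕ → ℕ
  least P? zero = zero
  least P? (suc n) with P? (least P? n)
  ... | yes _ = least P? n
  ... | no _  = suc n

  module _ {P : ℕ → Set} (P? : ∀ m → Dec (P m)) where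

    private
      least-satisfies-or-bound : ∀ n → P (least P? n) ⊎ least P? n ≡ n
      least-satisfies-or-bound zero = inj₂ refl
      least-satisfies-or-bound (suc n) with P? (least P? n)
      ... | yes p = inj₁ p
      ... | no _  = inj₂ refl

    least-minimal : ∀ n m → m < least P? n → ¬ P m
    least-minimal (suc n) m m<l with P? (least P? n) | least-satisfies-or-bound n
    ... | yes _ | _      = least-minimal n m m<l
    ... | no ¬p | inj₁ p = ⊥-elim (¬p p)
    ... | no ¬p | inj₂ e with m <? n
    ...   | yes m<n = least-minimal n m (subst (m <_) (sym e) m<n)
    ...   | no m≮n  = subst (λ z → ¬ P z) (trans e (≤-antisym (≮⇒≥ m≮n) (s≤s⁻¹ m<l))) ¬p

    least-satisfies : ∀ n m → m ≤ n → P m → P (least P? n)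
    least-satisfies zero .zero z≤n pm = pm
    least-satisfies (suc n) m m≤n pm with P? (least P? n) | least-satisfies-or-bound n
    ... | yes p | _      = p
    ... | no ¬p | inj₁ p = ⊥-elim (¬p p)
    ... | no ¬p | inj₂ e with m ≤? n
    ...   | yes m≤n′ = ⊥-elim (¬p (least-satisfies n m m≤n′ pm))
    ...   | no m≰n′  = subst P (≤-antisym m≤n (≰⇒> m≰n′)) pm

    least-≤ : ∀ n m → P m → least P? n ≤ m
    least-≤ n m pm with least P? n ≤? m
    ... | yes l≤m = l≤m
    ... | no l≰m  = ⊥-elim (least-minimal n m (≰⇒> l≰m) pm)

    least≤bound : ∀ n → least P? n ≤ n
    least≤bound zero = z≤n
    least≤bound (suc n) with P? (least P? n)
    ... | yes _ = m≤n⇒m≤1+n (least≤bound n)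
    ... | no _  = ≤-refl

    least-unique : ∀ n x → x ≤ n → P x → (∀ m → P m → x ≤ m) → least P? n ≡ x
    least-unique n x x≤n px x-least with <-cmp (least P? n) x
    ... | tri≈ _ l≡x _ = l≡x
    ... | tri< l<x _ _ = ⊥-elim (<⇒≱ l<x (x-least _ (least-satisfies n x x≤n px)))
    ... | tri> _ _ x<l = ⊥-elim (least-minimal n x x<l px)


module ParkingCount where

  open import Data.Nat
  open import Data.Nat.Properties
  open import Data.Fin using (Fin; zero; suc; toℕ; fromℕ<)
  open import Data.Fin.Properties using (toℕ<n; toℕ-fromℕ<)
  open import Data.Vec as Vec using (Vec; toList)
  open import Data.Vec.Properties using (length-toList)
  open import Data.List using (List; []; _∷_; length; lookup)
  open import Data.List.Relation.Unary.Linked as Linked using (Linked; _∷_)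
  open import Data.List.Relation.Binary.Permutation.Propositional using (_↭_; prep; swap) renaming (refl to ↭-refl; trans to ↭-trans)
  open import Data.List.Relation.Binary.Permutation.Propositional.Properties using (↭-length)
  open import Data.List.Sort ≤-decTotalOrder using (sort; sort-↭; sort-↗)
  open import Data.Product using (_,_)
  open import Data.Empty using (⊥-elim)
  open import Relation.Nullary using (yes; no)
  open import Relation.Binary.PropositionalEquality
  open import Function using (_∘′_)
  open Counting using (count; sucIf)

  countAtMost : ℕ → List ℕ → ℕ
  countAtMost t []       = 0
  countAtMost t (x ∷ xs) = sucIf (x ≤? t) (countAtMost t xs)

  countAtMost-↭ : ∀ t {xs ys} → xs ↭ ys → countAtMost t xs ≡ countAtMost t ys
  countAtMost-↭ t ↭-refl = refl
  countAtMost-↭ t (prep x p) = cong (sucIf (x ≤? t)) (countAtMost-↭ t p)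
  countAtMost-↭ t (swap x y p) with x ≤? t | y ≤? t
  ... | yes _ | yes _ = cong (suc ∘′ suc) (countAtMost-↭ t p)
  ... | yes _ | no _  = cong suc (countAtMost-↭ t p)
  ... | no _  | yes _ = cong suc (countAtMost-↭ t p)
  ... | no _  | no _  = countAtMost-↭ t p
  countAtMost-↭ t (↭-trans p q) = trans (countAtMost-↭ t p) (countAtMost-↭ t q)

  countAtMost-toList : ∀ t {n} (a : Vec ℕ n) → countAtMost t (toList a) ≡ count (λ i → Vec.lookup a i ≤? t)
  countAtMost-toList t Vec.[] = refl
  countAtMost-toList t (x Vec.∷ a) = cong (sucIf (x ≤? t)) (countAtMost-toList t a)

  Linked⇒head≤ : ∀ {x xs} → Linked _≤_ (x ∷ xs) → ∀ i → x ≤ lookup xs i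
  Linked⇒head≤ (x≤y ∷ _) zero = x≤y
  Linked⇒head≤ {xs = _ ∷ _ ∷ _} (x≤y ∷ sorted) (suc i) = ≤-trans x≤y (Linked⇒head≤ sorted i)

  sorted⇒position<countAtMost : ∀ t {b} → Linked _≤_ b → (c : Fin (length b)) →
                                lookup b c ≤ t → toℕ c < countAtMost t b
  sorted⇒position<countAtMost t {x ∷ xs} sorted zero bc≤t with x ≤? t
  ... | yes _  = s≤s z≤n
  ... | no x≰t = ⊥-elim (x≰t bc≤t)
  sorted⇒position<countAtMost t {x ∷ xs} sorted (suc c) bc≤t with x ≤? t
  ... | yes _  = s≤s (sorted⇒position<countAtMost t (Linked.tail sorted) c bc≤t)
  ... | no x≰t = ⊥-elim (x≰t (≤-trans (Linked⇒head≤ sorted c) bc≤t))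

  sorted⇒countAtMost≤position : ∀ t {b} → Linked _≤_ b → (c : Fin (length b)) →
                                t < lookup b c → countAtMost t b ≤ toℕ c
  sorted⇒countAtMost≤position t {x ∷ xs} sorted zero t<x with x ≤? t
  ... | yes x≤t = ⊥-elim (<⇒≱ t<x x≤t)
  ... | no _    = ≤-reflexive (noneAtMost xs (Linked⇒head≤ sorted))
    where
    noneAtMost : ∀ ys → (∀ i → x ≤ lookup ys i) → countAtMost t ys ≡ 0
    noneAtMost []       _   = refl
    noneAtMost (y ∷ ys) x≤ys with y ≤? t
    ... | yes y≤t = ⊥-elim (<⇒≱ (<-≤-trans t<x (x≤ys zero)) y≤t)
    ... | no _    = noneAtMost ys (λ i → x≤ys (suc i))
  sorted⇒countAtMost≤position t {x ∷ xs} sorted (suc c) t<bc with x ≤? t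
  ... | yes _ = s≤s (sorted⇒countAtMost≤position t (Linked.tail sorted) c t<bc)
  ... | no _  = m≤n⇒m≤1+n (sorted⇒countAtMost≤position t (Linked.tail sorted) c t<bc)

  CountCondition : ℕ → (K : ℕ) → Vec ℕ K → Set
  CountCondition r K a = ∀ c → c < K → suc c ≤ count (λ i → Vec.lookup a i ≤? r * c)

  parking⇒countCondition : ∀ r K (a : Vec ℕ K) → IsParkingFunction r K a → CountCondition r K a
  parking⇒countCondition r K a (b , b↭a , sorted , b≤) c c<K = begin
    suc c                          ≡⟨ cong suc (sym (toℕ-fromℕ< c<b)) ⟩
    suc (toℕ c′)                   ≤⟨ sorted⇒position<countAtMost (r * c) sorted c′ bc′≤rc ⟩
    countAtMost (r * c) b          ≡⟨ countAtMost-↭ (r * c) b↭a ⟩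
    countAtMost (r * c) (toList a) ≡⟨ countAtMost-toList (r * c) a ⟩
    count (λ i → Vec.lookup a i ≤? r * c) ∎
    where
    open ≤-Reasoning
    c<b : c < length b
    c<b = subst (c <_) (sym (trans (↭-length b↭a) (length-toList a))) c<K
    c′ = fromℕ< c<b
    bc′≤rc : lookup b c′ ≤ r * c
    bc′≤rc = subst (λ z → lookup b c′ ≤ r * z) (toℕ-fromℕ< c<b) (b≤ c′)

  countCondition⇒parking : ∀ r K (a : Vec ℕ K) → CountCondition r K a → IsParkingFunction r K a
  countCondition⇒parking r K a cc = b , sort-↭ (toList a) , sort-↗ (toList a) , b≤
    where
    b = sort (toList a)
    b≤ : ∀ i → lookup b i ≤ r * toℕ i
    b≤ i with lookup b i ≤? r * toℕ i
    ... | yes bi≤ = bi≤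
    ... | no bi≰ = ⊥-elim (<⇒≱ enough (sorted⇒countAtMost≤position (r * toℕ i) (sort-↗ (toList a)) i (≰⇒> bi≰)))
      where
      i<K : toℕ i < K
      i<K = subst (toℕ i <_) (trans (↭-length (sort-↭ (toList a))) (length-toList a)) (toℕ<n i)
      enough : toℕ i < countAtMost (r * toℕ i) b
      enough = subst (toℕ i <_)
                 (sym (trans (countAtMost-↭ (r * toℕ i) (sort-↭ (toList a))) (countAtMost-toList (r * toℕ i) a)))
                 (cc (toℕ i) i<K)


module BreadthFirstRank where

  open import Data.Nat
  open import Data.Nat.Properties
  open import Data.Fin using (Fin; toℕ; fromℕ<; punchOut)
  open import Data.Fin.Properties as Fin using (toℕ-injective; toℕ-fromℕ<; punchOut-injective; injective⇒≤; any?)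
  open import Data.Product using (∃; _×_; _,_)
  open import Data.Sum using (_⊎_; inj₁; inj₂)
  open import Data.Empty using (⊥-elim)
  open import Relation.Nullary using (Dec; yes; no; ¬_)
  open import Relation.Nullary.Decidable using (_⊎-dec_; _×-dec_)
  open import Relation.Binary.PropositionalEquality
  open import Relation.Binary.Definitions using (tri<; tri≈; tri>)
  open Counting

  injective⇒surjective : ∀ {n} (f : Fin n → Fin n) → (∀ {x y} → f x ≡ f y → x ≡ y) → ∀ c → ∃ λ j → f j ≡ c
  injective⇒surjective {suc n} f f-inj c with any? (λ j → f j Fin.≟ c)
  ... | yes hit = hit
  ... | no miss = ⊥-elim (<-irrefl refl (injective⇒≤ {f = g} g-inj))
    where
    c≢f : ∀ j → c ≢ f j
    c≢f j c≡fj = miss (j , sym c≡fj)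
    g : Fin (suc n) → Fin n
    g j = punchOut (c≢f j)
    g-inj : ∀ {x y} → g x ≡ g y → x ≡ y
    g-inj {x} {y} gx≡gy = f-inj (punchOut-injective (c≢f x) (c≢f y) gx≡gy)

  module _ {K : ℕ} (level : Fin K → ℕ) where

    Precedes : Fin K → Fin K → Set
    Precedes i j = level i < level j ⊎ (level i ≡ level j × toℕ i < toℕ j)

    precedes? : ∀ i j → Dec (Precedes i j)
    precedes? i j = (level i <? level j) ⊎-dec ((level i ≟ level j) ×-dec (toℕ i <? toℕ j))

    precedes-irrefl : ∀ i → ¬ Precedes i i
    precedes-irrefl i (inj₁ ℓi<ℓi)      = <-irrefl refl ℓi<ℓi
    precedes-irrefl i (inj₂ (_ , i<i)) = <-irrefl refl i<i

    precedes-trans : ∀ {i j k} → Precedes i j → Precedes j k → Precedes i k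
    precedes-trans (inj₁ a) (inj₁ b) = inj₁ (<-trans a b)
    precedes-trans {i} (inj₁ a) (inj₂ (e , _)) = inj₁ (subst (level i <_) e a)
    precedes-trans {k = k} (inj₂ (e , _)) (inj₁ b) = inj₁ (subst (_< level k) (sym e) b)
    precedes-trans (inj₂ (e , a)) (inj₂ (e′ , b)) = inj₂ (trans e e′ , <-trans a b)

    precedes-connex : ∀ i j → i ≢ j → Precedes i j ⊎ Precedes j i
    precedes-connex i j i≢j with <-cmp (level i) (level j)
    ... | tri< a _ _ = inj₁ (inj₁ a)
    ... | tri> _ _ c = inj₂ (inj₁ c)
    ... | tri≈ _ e _ with <-cmp (toℕ i) (toℕ j)
    ...   | tri< a _ _  = inj₁ (inj₂ (e , a))
    ...   | tri≈ _ e′ _ = ⊥-elim (i≢j (toℕ-injective e′))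
    ...   | tri> _ _ c  = inj₂ (inj₂ (sym e , c))

    rank : Fin K → ℕ
    rank j = count (λ i → precedes? i j)

    rank<K : ∀ j → rank j < K
    rank<K j = count<n (λ i → precedes? i j) j (precedes-irrefl j)

    rank-mono : ∀ {i j} → Precedes i j → rank i < rank j
    rank-mono {i} {j} i≺j =
      count-mono-< (λ x → precedes? x i) (λ x → precedes? x j) (λ x x≺i → precedes-trans x≺i i≺j) i i≺j (precedes-irrefl i)

    rank-injective : ∀ {i j} → rank i ≡ rank j → i ≡ j
    rank-injective {i} {j} ri≡rj with i Fin.≟ j
    ... | yes i≡j = i≡j
    ... | no i≢j with precedes-connex i j i≢j
    ...   | inj₁ i≺j = ⊥-elim (<-irrefl ri≡rj (rank-mono i≺j))
    ...   | inj₂ j≺i = ⊥-elim (<-irrefl (sym ri≡rj) (rank-mono j≺i))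

    rank-surjective : ∀ c → c < K → ∃ λ j → rank j ≡ c
    rank-surjective c c<K =
      let j , rj≡c = injective⇒surjective rankFin rankFin-injective (fromℕ< c<K)
      in  j , trans (sym (toℕ-fromℕ< (rank<K j))) (trans (cong toℕ rj≡c) (toℕ-fromℕ< c<K))
      where
      rankFin : Fin K → Fin K
      rankFin j = fromℕ< (rank<K j)
      rankFin-injective : ∀ {x y} → rankFin x ≡ rankFin y → x ≡ y
      rankFin-injective {x} {y} e =
        rank-injective (trans (sym (toℕ-fromℕ< (rank<K x))) (trans (cong toℕ e) (toℕ-fromℕ< (rank<K y))))

    level≤⇒rank<count : ∀ d j → level j ≤ d → rank j < count (λ i → level i ≤? d)
    level≤⇒rank<count d j ℓj≤d = count-mono-< (λ x → precedes? x j) (λ i → level i ≤? d) below j ℓj≤d (precedes-irrefl j)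
      where
      below : ∀ x → Precedes x j → level x ≤ d
      below x (inj₁ ℓx<ℓj)      = ≤-trans (<⇒≤ ℓx<ℓj) ℓj≤d
      below x (inj₂ (ℓx≡ℓj , _)) = subst (_≤ d) (sym ℓx≡ℓj) ℓj≤d

    rank<count⇒level≤ : ∀ d j → rank j < count (λ i → level i ≤? d) → level j ≤ d
    rank<count⇒level≤ d j r<c with level j ≤? d
    ... | yes ℓj≤d = ℓj≤d
    ... | no ℓj≰d  = ⊥-elim (<⇒≱ r<c (count-mono (λ i → level i ≤? d) (λ x → precedes? x j)
                                        (λ x ℓx≤d → inj₁ (≤-<-trans ℓx≤d (≰⇒> ℓj≰d)))))

    count-precedes-or-≡ : ∀ j → count (λ i → precedes? i j ⊎-dec i Fin.≟ j) ≡ suc (rank j)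
    count-precedes-or-≡ j = trans (count-⊎ (λ i → precedes? i j) (Fin._≟ j)
                                     (λ i i≺j i≡j → precedes-irrefl j (subst (λ z → Precedes z j) i≡j i≺j)))
                                  (trans (cong (rank j +_) (count-≡ j)) (+-comm (rank j) 1))

  rank-cong : ∀ {K} (ℓ ℓ′ : Fin K → ℕ) → (∀ i → ℓ i ≡ ℓ′ i) → ∀ j → rank ℓ j ≡ rank ℓ′ j
  rank-cong ℓ ℓ′ ℓ≗ℓ′ j = count-cong (λ i → precedes? ℓ i j) (λ i → precedes? ℓ′ i j)
                            (λ i → transport ℓ ℓ′ ℓ≗ℓ′) (λ i → transport ℓ′ ℓ (λ x → sym (ℓ≗ℓ′ x)))
    where
    transport : ∀ ℓ ℓ′ → (∀ i → ℓ i ≡ ℓ′ i) → ∀ {i} → Precedes ℓ i j → Precedes ℓ′ i j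
    transport ℓ ℓ′ e {i} (inj₁ a)       = inj₁ (subst₂ _<_ (e i) (e j) a)
    transport ℓ ℓ′ e {i} (inj₂ (q , a)) = inj₂ (trans (sym (e i)) (trans q (e j)) , a)


module ParentsAndParking (r′ K : ℕ) where

  open import Data.Nat
  open import Data.Nat.Properties
  open import Data.Nat.DivMod using (_%_; _/_; _mod_; m≡m%n+[m/n]*n; m%n<n)
  open import Data.Fin using (Fin; toℕ)
  open import Data.Fin.Properties as Fin using (toℕ<n; toℕ-injective; toℕ-fromℕ<; any?)
  open import Data.Vec using (Vec; tabulate; lookup)
  open import Data.Vec.Properties using (lookup∘tabulate; tabulate-cong; tabulate∘lookup)
  open import Data.Maybe as Maybe using (Maybe; just; nothing; maybe′)
  open import Data.Product using (Σ; _×_; _,_; proj₁; proj₂)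
  open import Data.Sum using (_⊎_; inj₁; inj₂)
  open import Data.Empty using (⊥-elim)
  open import Relation.Nullary using (yes; no)
  open import Relation.Nullary.Decidable using (_⊎-dec_)
  open import Relation.Binary.PropositionalEquality
  open import Relation.Binary.Definitions using (tri<; tri≈; tri>)
  open Counting
  open LeastSearch
  open ParkingCount using (CountCondition)
  open BreadthFirstRank

  R : ℕ
  R = suc r′

  -- The parent of a block: nothing is the special vertex, just (j′ , i) the i-th vertex of block j′.
  Parent : Set
  Parent = Maybe (Fin K × Fin R)

  Parents : Set
  Parents = Fin K → Parent

  Decreasing : Parents → (Fin K → ℕ) → Set
  Decreasing par h = ∀ j j′ i → par j ≡ just (j′ , i) → h j′ < h j

  HasHeight : Parents → Set
  HasHeight par = Σ (Fin K → ℕ) λ h → (∀ j → h j ≤ K) × Decreasing par h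

  IsDepth : Parents → (Fin K → ℕ) → Set
  IsDepth par e = (∀ j → par j ≡ nothing → e j ≡ 0) ×
                  (∀ j j′ i → par j ≡ just (j′ , i) → e j ≡ suc (e j′))

  t<c⇒R*t+i<R*c : ∀ {t c i} → i < R → t < c → R * t + i < R * c
  t<c⇒R*t+i<R*c {t} {c} {i} i<R t<c = begin
    suc (R * t + i) ≡⟨ sym (+-suc (R * t) i) ⟩
    R * t + suc i   ≤⟨ +-monoʳ-≤ (R * t) i<R ⟩
    R * t + R       ≡⟨ trans (+-comm (R * t) R) (sym (*-suc R t)) ⟩
    R * suc t       ≤⟨ *-monoʳ-≤ R t<c ⟩
    R * c           ∎
    where open ≤-Reasoning

  R*t+i<R*c⇒t<c : ∀ {t c} i → R * t + i < R * c → t < c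
  R*t+i<R*c⇒t<c {t} {c} i lt with t <? c
  ... | yes t<c = t<c
  ... | no t≮c  = ⊥-elim (<⇒≱ lt (≤-trans (*-monoʳ-≤ R (≮⇒≥ t≮c)) (m≤m+n (R * t) i)))

  R*t+i-injective : ∀ {t t′ i i′} → i < R → i′ < R → R * t + i ≡ R * t′ + i′ → t ≡ t′ × i ≡ i′
  R*t+i-injective {t} {t′} {i} {i′} i<R i′<R eq with <-cmp t t′
  ... | tri< t<t′ _ _ = ⊥-elim (<-irrefl eq (<-≤-trans (t<c⇒R*t+i<R*c i<R t<t′) (m≤m+n (R * t′) i′)))
  ... | tri> _ _ t′<t = ⊥-elim (<-irrefl (sym eq) (<-≤-trans (t<c⇒R*t+i<R*c i′<R t′<t) (m≤m+n (R * t) i)))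
  ... | tri≈ _ refl _ = refl , +-cancelˡ-≡ (R * t) i i′ eq

  q≡R*[q/R]+q%R : ∀ q → q ≡ R * (q / R) + toℕ (q mod R)
  q≡R*[q/R]+q%R q = trans (m≡m%n+[m/n]*n q R) (trans (+-comm (q % R) ((q / R) * R))
                      (cong₂ _+_ (*-comm (q / R) R) (sym (toℕ-fromℕ< (m%n<n q R)))))

  depthWithin : Parents → ℕ → Fin K → ℕ
  depthWithin par zero    j = 0
  depthWithin par (suc n) j = maybe′ (λ p → suc (depthWithin par n (proj₁ p))) 0 (par j)

  depth : Parents → Fin K → ℕ
  depth par = depthWithin par (suc K)

  depthWithin-stable : ∀ {par h} → Decreasing par h → ∀ n j → h j < n →
                       depthWithin par n j ≡ depthWithin par (suc n) j
  depthWithin-stable {par} dec (suc n) j hj<n with par j in eq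
  ... | nothing       = refl
  ... | just (j′ , i) = cong suc (depthWithin-stable dec n j′ (<-≤-trans (dec j j′ i eq) (s≤s⁻¹ hj<n)))

  depth-isDepth : ∀ {par} → HasHeight par → IsDepth par (depth par)
  depth-isDepth {par} (h , h≤K , dec) = root , child
    where
    root : ∀ j → par j ≡ nothing → depth par j ≡ 0
    root j eq rewrite eq = refl
    child : ∀ j j′ i → par j ≡ just (j′ , i) → depth par j ≡ suc (depth par j′)
    child j j′ i eq rewrite eq = cong suc (depthWithin-stable dec K j′ (<-≤-trans (dec j j′ i eq) (h≤K j)))

  depthWithin≤height : ∀ {par h} → Decreasing par h → ∀ n j → depthWithin par n j ≤ h j
  depthWithin≤height dec zero j = z≤n
  depthWithin≤height {par} dec (suc n) j with par j in eq
  ... | nothing       = z≤n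
  ... | just (j′ , i) = ≤-trans (s≤s (depthWithin≤height dec n j′)) (dec j j′ i eq)

  depth≤K : ∀ {par} → HasHeight par → ∀ j → depth par j ≤ K
  depth≤K (h , h≤K , dec) j = ≤-trans (depthWithin≤height dec (suc K) j) (h≤K j)

  isDepth⇒depth≡ : ∀ {par e} → IsDepth par e → (∀ j → e j ≤ K) → ∀ j → depth par j ≡ e j
  isDepth⇒depth≡ {par} {e} (root , child) e≤K j = within (suc K) j (s≤s (e≤K j))
    where
    within : ∀ n j → e j < n → depthWithin par n j ≡ e j
    within (suc n) j ej<n with par j in eq
    ... | nothing       = sym (root j eq)
    ... | just (j′ , i) = trans (cong suc (within n j′ (s≤s⁻¹ (subst (_< suc n) (child j j′ i eq) ej<n))))
                                (sym (child j j′ i eq))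

  depthWithin-cong : ∀ {par par′} → (∀ j → par j ≡ par′ j) → ∀ n j → depthWithin par n j ≡ depthWithin par′ n j
  depthWithin-cong par≗par′ zero j = refl
  depthWithin-cong {par′ = par′} par≗par′ (suc n) j rewrite par≗par′ j with par′ j
  ... | nothing       = refl
  ... | just (j′ , i) = cong suc (depthWithin-cong par≗par′ n j′)

  parkingValue : (Fin K → ℕ) → Parent → ℕ
  parkingValue rk nothing         = 0
  parkingValue rk (just (j′ , i)) = suc (R * rk j′ + toℕ i)

  parkingValue-cong : ∀ {rk rk′} → (∀ j → rk j ≡ rk′ j) → ∀ p → parkingValue rk p ≡ parkingValue rk′ p
  parkingValue-cong rk≗rk′ nothing         = refl
  parkingValue-cong rk≗rk′ (just (j′ , i)) = cong (λ t → suc (R * t + toℕ i)) (rk≗rk′ j′)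

  toParking : Parents → Vec ℕ K
  toParking par = tabulate (λ j → parkingValue (rank (depth par)) (par j))

  lookup-toParking : ∀ par j → lookup (toParking par) j ≡ parkingValue (rank (depth par)) (par j)
  lookup-toParking par = lookup∘tabulate (λ j → parkingValue (rank (depth par)) (par j))

  toParking-cong : ∀ {par par′} → (∀ j → par j ≡ par′ j) → toParking par ≡ toParking par′
  toParking-cong {par} {par′} par≗par′ = tabulate-cong λ j →
    trans (cong (parkingValue (rank (depth par))) (par≗par′ j))
          (parkingValue-cong (rank-cong (depth par) (depth par′) (depthWithin-cong par≗par′ (suc K))) (par′ j))

  parentValue<⇒level≤ : ∀ (ℓ : Fin K → ℕ) d j′ i →
                        suc (R * rank ℓ j′ + i) ≤ R * count (λ x → ℓ x ≤? d) → ℓ j′ ≤ d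
  parentValue<⇒level≤ ℓ d j′ i lt = rank<count⇒level≤ ℓ d j′ (R*t+i<R*c⇒t<c i lt)

  level≤⇒parentValue< : ∀ (ℓ : Fin K → ℕ) d j′ {i} → i < R → ℓ j′ ≤ d →
                        suc (R * rank ℓ j′ + i) ≤ R * count (λ x → ℓ x ≤? d)
  level≤⇒parentValue< ℓ d j′ i<R ℓj′≤d = t<c⇒R*t+i<R*c i<R (level≤⇒rank<count ℓ d j′ ℓj′≤d)

  -- The parent block precedes the block in the breadth-first order.
  toParking≤R*rank : ∀ {par} → HasHeight par → ∀ j → lookup (toParking par) j ≤ R * rank (depth par) j
  toParking≤R*rank {par} hh j = subst (_≤ R * rank ℓ j) (sym (lookup-toParking par j)) (bound (par j) refl)
    where
    ℓ = depth par
    bound : ∀ p → par j ≡ p → parkingValue (rank ℓ) p ≤ R * rank ℓ j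
    bound nothing         _  = z≤n
    bound (just (j′ , i)) eq = t<c⇒R*t+i<R*c (toℕ<n i)
                                 (rank-mono ℓ (inj₁ (≤-reflexive (sym (proj₂ (depth-isDepth hh) j j′ i eq)))))

  toParking-countCondition : ∀ {par} → HasHeight par → CountCondition R K (toParking par)
  toParking-countCondition {par} hh c c<K = begin
    suc c                                               ≡⟨ cong suc (sym rj≡c) ⟩
    suc (rank ℓ j)                                      ≡⟨ sym (count-precedes-or-≡ ℓ j) ⟩
    count (λ i → precedes? ℓ i j ⊎-dec i Fin.≟ j)       ≤⟨ count-mono _ _ below ⟩
    count (λ i → lookup (toParking par) i ≤? R * c)     ∎
    where
    open ≤-Reasoning
    ℓ = depth par
    j = proj₁ (rank-surjective ℓ c c<K)
    rj≡c = proj₂ (rank-surjective ℓ c c<K)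
    below : ∀ i → Precedes ℓ i j ⊎ i ≡ j → lookup (toParking par) i ≤ R * c
    below i (inj₁ i≺j) = ≤-trans (toParking≤R*rank hh i) (*-monoʳ-≤ R (subst (rank ℓ i ≤_) rj≡c (<⇒≤ (rank-mono ℓ i≺j))))
    below i (inj₂ refl) = subst (λ t → lookup (toParking par) i ≤ R * t) rj≡c (toParking≤R*rank hh i)

  module Levels (a : Vec ℕ K) where

    atMost : ℕ → ℕ
    atMost t = count (λ i → lookup a i ≤? t)

    atMost-mono : ∀ {t t′} → t ≤ t′ → atMost t ≤ atMost t′
    atMost-mono {t} {t′} t≤t′ =
      count-mono (λ i → lookup a i ≤? t) (λ i → lookup a i ≤? t′) (λ i ai≤t → ≤-trans ai≤t t≤t′)

    -- For a = toParking par, the blocks of depth d + 1 get exactly the values in (threshold d , threshold (d + 1)].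
    threshold : ℕ → ℕ
    threshold zero    = 0
    threshold (suc d) = R * atMost (threshold d)

    threshold-suc : ∀ d → threshold d ≤ threshold (suc d)
    threshold-suc zero    = z≤n
    threshold-suc (suc d) = *-monoʳ-≤ R (atMost-mono (threshold-suc d))

    threshold-mono : ∀ {d d′} → d ≤ d′ → threshold d ≤ threshold d′
    threshold-mono d≤d′ = mono (≤⇒≤′ d≤d′)
      where
      mono : ∀ {d d′} → d ≤′ d′ → threshold d ≤ threshold d′
      mono ≤′-refl          = ≤-refl
      mono (≤′-step {n} d≤n) = ≤-trans (mono d≤n) (threshold-suc n)

    level : Fin K → ℕ
    level j = least (λ d → lookup a j ≤? threshold d) K

    level≤K : ∀ j → level j ≤ K
    level≤K j = least≤bound (λ d → lookup a j ≤? threshold d) K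

    level≤ : ∀ j d → lookup a j ≤ threshold d → level j ≤ d
    level≤ j = least-≤ (λ d → lookup a j ≤? threshold d) K

    module _ (cc : CountCondition R K a) where

      atMost-grows : ∀ d → d ≤ atMost (threshold d) ⊎ atMost (threshold d) ≡ K
      atMost-grows zero = inj₁ z≤n
      atMost-grows (suc d) with atMost-grows d | atMost (threshold d) <? K
      ... | inj₂ full | _ = inj₂ (≤-antisym (count≤n _) (subst (_≤ atMost (threshold (suc d))) full (atMost-mono (threshold-suc d))))
      ... | inj₁ d≤ | yes notFull = inj₁ (≤-trans (s≤s d≤) (cc _ notFull))
      ... | inj₁ _  | no full     = inj₂ (≤-antisym (count≤n _) (≤-trans (≮⇒≥ full) (atMost-mono (threshold-suc d))))

      ≤threshold-K : ∀ j → lookup a j ≤ threshold K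
      ≤threshold-K j with lookup a j ≤? threshold K
      ... | yes aj≤ = aj≤
      ... | no aj≰  = ⊥-elim (<-irrefl full (count<n (λ i → lookup a i ≤? threshold K) j aj≰))
        where
        full : atMost (threshold K) ≡ K
        full with atMost-grows K
        ... | inj₁ K≤ = ≤-antisym (count≤n _) K≤
        ... | inj₂ ≡K = ≡K

      ≤threshold-level : ∀ j → lookup a j ≤ threshold (level j)
      ≤threshold-level j = least-satisfies (λ d → lookup a j ≤? threshold d) K K ≤-refl (≤threshold-K j)

      level≤⇒≤threshold : ∀ j d → level j ≤ d → lookup a j ≤ threshold d
      level≤⇒≤threshold j d lj≤d = ≤-trans (≤threshold-level j) (threshold-mono lj≤d)

      atMost-threshold : ∀ d → atMost (threshold d) ≡ count (λ i → level i ≤? d)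
      atMost-threshold d = count-cong _ _ (λ i → level≤ i d) (λ i → level≤⇒≤threshold i d)

  unrank : (Fin K → ℕ) → ℕ → Maybe (Fin K)
  unrank ℓ t with any? (λ j → rank ℓ j ≟ t)
  ... | yes (j , _) = just j
  ... | no _        = nothing

  unrank-rank : ∀ ℓ j → unrank ℓ (rank ℓ j) ≡ just j
  unrank-rank ℓ j with any? (λ j′ → rank ℓ j′ ≟ rank ℓ j)
  ... | yes (j′ , rj′≡rj) = cong just (rank-injective ℓ rj′≡rj)
  ... | no none           = ⊥-elim (none (j , refl))

  decodeValue : (Fin K → ℕ) → ℕ → Parent
  decodeValue ℓ zero    = nothing
  decodeValue ℓ (suc q) = Maybe.map (λ j′ → j′ , q mod R) (unrank ℓ (q / R))

  decodeValue-parkingValue : ∀ ℓ p → decodeValue ℓ (parkingValue (rank ℓ) p) ≡ p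
  decodeValue-parkingValue ℓ nothing = refl
  decodeValue-parkingValue ℓ (just (j′ , i)) = begin
    Maybe.map (λ j″ → j″ , q mod R) (unrank ℓ (q / R))
      ≡⟨ cong₂ (λ t k → Maybe.map (λ j″ → j″ , k) (unrank ℓ t)) t≡ (toℕ-injective i≡) ⟩
    Maybe.map (λ j″ → j″ , i) (unrank ℓ (rank ℓ j′))   ≡⟨ cong (Maybe.map (λ j″ → j″ , i)) (unrank-rank ℓ j′) ⟩
    just (j′ , i)                                     ∎
    where
    open ≡-Reasoning
    q = R * rank ℓ j′ + toℕ i
    t≡ = proj₁ (R*t+i-injective (toℕ<n (q mod R)) (toℕ<n i) (sym (q≡R*[q/R]+q%R q)))
    i≡ = proj₂ (R*t+i-injective (toℕ<n (q mod R)) (toℕ<n i) (sym (q≡R*[q/R]+q%R q)))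

  parkingValue-decodeValue : ∀ ℓ q → q / R < K → parkingValue (rank ℓ) (decodeValue ℓ (suc q)) ≡ suc q
  parkingValue-decodeValue ℓ q q/R<K = begin
    parkingValue (rank ℓ) (Maybe.map (λ j″ → j″ , q mod R) (unrank ℓ (q / R)))
      ≡⟨ cong (λ u → parkingValue (rank ℓ) (Maybe.map (λ j″ → j″ , q mod R) u))
              (trans (cong (unrank ℓ) (sym rj′≡)) (unrank-rank ℓ j′)) ⟩
    suc (R * rank ℓ j′ + toℕ (q mod R)) ≡⟨ cong (λ t → suc (R * t + toℕ (q mod R))) rj′≡ ⟩
    suc (R * (q / R) + toℕ (q mod R))   ≡⟨ cong suc (sym (q≡R*[q/R]+q%R q)) ⟩
    suc q                               ∎
    where
    open ≡-Reasoning
    j′ = proj₁ (rank-surjective ℓ (q / R) q/R<K)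
    rj′≡ = proj₂ (rank-surjective ℓ (q / R) q/R<K)

  fromParking : Vec ℕ K → Parents
  fromParking a j = decodeValue (Levels.level a) (lookup a j)

  module FromParking (a : Vec ℕ K) (cc : CountCondition R K a) where

    open Levels a

    value≤R*K : ∀ j → lookup a j ≤ R * K
    value≤R*K j with level j | ≤threshold-level cc j
    ... | zero  | aj≤0 = ≤-trans aj≤0 z≤n
    ... | suc l | aj≤  = ≤-trans aj≤ (*-monoʳ-≤ R (count≤n _))

    quotient<K : ∀ j q → lookup a j ≡ suc q → q / R < K
    quotient<K j q aj≡ = R*t+i<R*c⇒t<c (toℕ (q mod R))
                           (subst (_≤ R * K) (trans aj≡ (cong suc (q≡R*[q/R]+q%R q))) (value≤R*K j))

    parkingValue-fromParking : ∀ j → parkingValue (rank level) (decodeValue level (lookup a j)) ≡ lookup a j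
    parkingValue-fromParking j with lookup a j in aj≡
    ... | zero  = refl
    ... | suc q = parkingValue-decodeValue level q (quotient<K j q aj≡)

    level-child : ∀ j j′ i → lookup a j ≡ suc (R * rank level j′ + toℕ i) → level j ≡ suc (level j′)
    level-child j j′ i aj≡ = least-unique P? K (suc (level j′)) bound (from (level j′) ≤-refl) minimal
      where
      P? = λ d → lookup a j ≤? threshold d
      to : ∀ d → lookup a j ≤ threshold (suc d) → level j′ ≤ d
      to d aj≤ = parentValue<⇒level≤ level d j′ (toℕ i) (subst₂ _≤_ aj≡ (cong (R *_) (atMost-threshold cc d)) aj≤)
      from : ∀ d → level j′ ≤ d → lookup a j ≤ threshold (suc d)
      from d lj′≤d = subst₂ _≤_ (sym aj≡) (cong (R *_) (sym (atMost-threshold cc d)))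
                       (level≤⇒parentValue< level d j′ (toℕ<n i) lj′≤d)
      minimal : ∀ d → lookup a j ≤ threshold d → suc (level j′) ≤ d
      minimal zero    aj≤0 = ⊥-elim (n≮0 (subst (_≤ 0) aj≡ aj≤0))
      minimal (suc d) aj≤  = s≤s (to d aj≤)
      bound : suc (level j′) ≤ K
      bound = ≤-trans (minimal (level j) (≤threshold-level cc j)) (level≤K j)

    level-isDepth : IsDepth (fromParking a) level
    level-isDepth = root , child
      where
      value≡ : ∀ j {p} → fromParking a j ≡ p → lookup a j ≡ parkingValue (rank level) p
      value≡ j eq = trans (sym (parkingValue-fromParking j)) (cong (parkingValue (rank level)) eq)
      root : ∀ j → fromParking a j ≡ nothing → level j ≡ 0
      root j eq = n≤0⇒n≡0 (level≤ j 0 (≤-reflexive (value≡ j eq)))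
      child : ∀ j j′ i → fromParking a j ≡ just (j′ , i) → level j ≡ suc (level j′)
      child j j′ i eq = level-child j j′ i (value≡ j eq)

    fromParking-hasHeight : HasHeight (fromParking a)
    fromParking-hasHeight = level , level≤K , λ j j′ i eq → ≤-reflexive (sym (proj₂ level-isDepth j j′ i eq))

    depth-fromParking : ∀ j → depth (fromParking a) j ≡ level j
    depth-fromParking = isDepth⇒depth≡ level-isDepth level≤K

    toParking-fromParking : toParking (fromParking a) ≡ a
    toParking-fromParking = trans (tabulate-cong λ j →
                                     trans (parkingValue-cong (rank-cong _ _ depth-fromParking) (fromParking a j))
                                           (parkingValue-fromParking j))
                                  (tabulate∘lookup a)

  module ToParking (par : Parents) (hh : HasHeight par) where

    open Levels (toParking par)

    private
      ℓ = depth par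
      root = proj₁ (depth-isDepth hh)
      child = proj₂ (depth-isDepth hh)

    value≤threshold⇔depth≤ : ∀ d i → (lookup (toParking par) i ≤ threshold d → ℓ i ≤ d) ×
                                      (ℓ i ≤ d → lookup (toParking par) i ≤ threshold d)
    value≤threshold⇔depth≤ d i = byParent d (par i) refl
      where
      value≡ : ∀ {p} → par i ≡ p → lookup (toParking par) i ≡ parkingValue (rank ℓ) p
      value≡ eq = trans (lookup-toParking par i) (cong (parkingValue (rank ℓ)) eq)
      byParent : ∀ d p → par i ≡ p → (lookup (toParking par) i ≤ threshold d → ℓ i ≤ d) ×
                                      (ℓ i ≤ d → lookup (toParking par) i ≤ threshold d)
      byParent d nothing eq = (λ _ → ≤-trans (≤-reflexive (root i eq)) z≤n) ,
                              (λ _ → subst (_≤ threshold d) (sym (value≡ eq)) z≤n)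
      byParent zero (just (j′ , i′)) eq = (λ v≤0 → ⊥-elim (n≮0 (subst (_≤ 0) (value≡ eq) v≤0))) ,
                                          (λ ℓi≤0 → ⊥-elim (n≮0 (subst (_≤ 0) (child i j′ i′ eq) ℓi≤0)))
      byParent (suc d) (just (j′ , i′)) eq = to , from
        where
        atMost≡ : atMost (threshold d) ≡ count (λ x → ℓ x ≤? d)
        atMost≡ = count-cong _ _ (λ x → proj₁ (value≤threshold⇔depth≤ d x)) (λ x → proj₂ (value≤threshold⇔depth≤ d x))
        to : lookup (toParking par) i ≤ threshold (suc d) → ℓ i ≤ suc d
        to v≤ = subst (_≤ suc d) (sym (child i j′ i′ eq))
                  (s≤s (parentValue<⇒level≤ ℓ d j′ (toℕ i′) (subst₂ _≤_ (value≡ eq) (cong (R *_) atMost≡) v≤)))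
        from : ℓ i ≤ suc d → lookup (toParking par) i ≤ threshold (suc d)
        from ℓi≤ = subst₂ _≤_ (sym (value≡ eq)) (cong (R *_) (sym atMost≡))
                     (level≤⇒parentValue< ℓ d j′ (toℕ<n i′) (s≤s⁻¹ (subst (_≤ suc d) (child i j′ i′ eq) ℓi≤)))

    level≡depth : ∀ i → level i ≡ ℓ i
    level≡depth i = least-unique (λ d → lookup (toParking par) i ≤? threshold d) K (ℓ i) (depth≤K hh i)
                      (proj₂ (value≤threshold⇔depth≤ (ℓ i) i) ≤-refl) (λ d → proj₁ (value≤threshold⇔depth≤ d i))

    fromParking-toParking : ∀ j → fromParking (toParking par) j ≡ par j
    fromParking-toParking j = begin
      decodeValue level (lookup (toParking par) j)         ≡⟨ cong (decodeValue level) (lookup-toParking par j) ⟩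
      decodeValue level (parkingValue (rank ℓ) (par j))     ≡⟨ cong (decodeValue level) (parkingValue-cong rank≗ (par j)) ⟩
      decodeValue level (parkingValue (rank level) (par j)) ≡⟨ decodeValue-parkingValue level (par j) ⟩
      par j                                                 ∎
      where
      open ≡-Reasoning
      rank≗ : ∀ j′ → rank ℓ j′ ≡ rank level j′
      rank≗ = rank-cong ℓ level (λ x → sym (level≡depth x))


module Incidence where

  open import Data.Nat using (ℕ)
  open import Data.Fin.Subset using (Subset)
  open import Data.List using (List; []; _∷_; _∷ʳ_)
  open import Data.List.Relation.Unary.Linked using (Linked)
  open import Data.List.Relation.Unary.Unique.Propositional using (Unique)
  open import Data.Product using (_,_; proj₂)
  open import Relation.Binary.PropositionalEquality using (_≡_; refl; trans; sym; subst)
  open import Data.Sum using (inj₁; inj₂)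
  open import Defs using (Node; Adj; IsCycle)

  last : {A : Set} → A → List A → A
  last a []       = a
  last a (b ∷ bs) = last b bs

  -- IsCycle closes a cycle with a last-element function local to Defs; it agrees with ours by its defining equations.
  last-unique : {A : Set} (f : A → List A → A) → (∀ a → f a [] ≡ a) → (∀ a b bs → f a (b ∷ bs) ≡ f b bs) →
                ∀ a as → f a as ≡ last a as
  last-unique f f-[] f-∷ a []       = f-[] a
  last-unique f f-[] f-∷ a (b ∷ bs) = trans (f-∷ a b bs) (last-unique f f-[] f-∷ b bs)

  last-∷ʳ : {A : Set} (a : A) (as : List A) (z : A) → last a (as ∷ʳ z) ≡ z
  last-∷ʳ a []       z = refl
  last-∷ʳ a (b ∷ bs) z = last-∷ʳ b bs z


  -- The equation for IsCycle's local last-element function is formed before w and ws are bound, so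
  -- that unification can find that function.
  module _ {n : ℕ} {E : List (Subset n)} {p q : Node n E} where

    isCycle⁺ : ∀ w ws → Unique (p ∷ q ∷ w ∷ ws) → Linked (Adj E) (p ∷ q ∷ w ∷ ws) → Adj E (last w ws) p →
               IsCycle E (p ∷ q ∷ w ∷ ws)
    isCycle⁺ = let lastOf≡last = last-unique _ (λ _ → refl) (λ _ _ _ → refl) in
               λ w ws u linked closing → u , linked , subst (λ t → Adj E t p) (sym (lastOf≡last w ws)) closing

    isCycle⁻ : ∀ w ws → IsCycle E (p ∷ q ∷ w ∷ ws) → Adj E (last w ws) p
    isCycle⁻ = let lastOf≡last = last-unique _ (λ _ → refl) (λ _ _ _ → refl) in
               λ w ws c → subst (λ t → Adj E t p) (lastOf≡last w ws) (proj₂ (proj₂ c))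

  Adj-sym : ∀ {n} {E : List (Subset n)} {x y : Node n E} → Adj E x y → Adj E y x
  Adj-sym {x = inj₁ _} {inj₂ _} x∈y = x∈y
  Adj-sym {x = inj₂ _} {inj₁ _} y∈x = y∈x


module Walks {Node : Set} (Adj : Node → Node → Set) where

  open import Data.Nat
  open import Data.Nat.Properties
  open import Data.List using (List; []; _∷_; _∷ʳ_)
  open import Data.List.Relation.Unary.All as All using (All; []; _∷_)
  import Data.List.Relation.Unary.All.Properties as All
  open import Data.List.Relation.Unary.AllPairs as AllPairs using ([]; _∷_)
  import Data.List.Relation.Unary.AllPairs.Properties as AllPairs
  open import Data.List.Relation.Unary.Linked as Linked using (Linked; [-]; _∷_)
  open import Data.List.Relation.Unary.Unique.Propositional using (Unique)
  open import Data.Product using (Σ; _×_; _,_; proj₁; proj₂)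
  open import Data.Sum using (_⊎_; inj₁; inj₂)
  open import Data.Unit using (⊤; tt)
  open import Data.Empty using (⊥; ⊥-elim)
  open import Relation.Nullary using (Dec; yes; no)
  open import Relation.Binary.PropositionalEquality
  open Incidence using (last; last-∷ʳ)

  Linked-∷ʳ : ∀ a as z → Linked Adj (a ∷ as) → Adj (last a as) z → Linked Adj ((a ∷ as) ∷ʳ z)
  Linked-∷ʳ a []       z _             adj = adj ∷ [-]
  Linked-∷ʳ a (b ∷ bs) z (ab ∷ linked) adj = ab ∷ Linked-∷ʳ b bs z linked adj

  module NoCycle (Down : Node → Node → Set) (height : Node → ℕ)
                 (adj⇒down : ∀ {x y} → Adj x y → Down x y ⊎ Down y x)
                 (down-functional : ∀ {x y z} → Down x y → Down x z → y ≡ z)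
                 (down-decreasing : ∀ {x y} → Down x y → height y < height x) where

    NoBacktrack : List Node → Set
    NoBacktrack (a ∷ b ∷ c ∷ rest) = a ≢ c × NoBacktrack (b ∷ c ∷ rest)
    NoBacktrack _                  = ⊤

    EndsUpward : Node → Node → List Node → Set
    EndsUpward a b []         = Down b a
    EndsUpward a b (c ∷ rest) = EndsUpward b c rest

    upward-stays-upward : ∀ a b rest → Linked Adj (a ∷ b ∷ rest) → NoBacktrack (a ∷ b ∷ rest) → Down b a →
                          height a < height (last b rest) × EndsUpward a b rest
    upward-stays-upward a b []         _            _            up = down-decreasing up , up
    upward-stays-upward a b (c ∷ rest) (_ ∷ linked) (a≢c , noBt) up with adj⇒down (Linked.head linked)
    ... | inj₁ b↓c = ⊥-elim (a≢c (down-functional up b↓c))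
    ... | inj₂ c↓b = let a<last , ends = upward-stays-upward b c rest linked noBt c↓b
                     in  <-trans (down-decreasing up) a<last , ends

    descends-or-ends-upward : ∀ a b rest → Linked Adj (a ∷ b ∷ rest) → NoBacktrack (a ∷ b ∷ rest) →
                              height (last b rest) < height a ⊎ EndsUpward a b rest
    descends-or-ends-upward a b [] (ab ∷ _) _ with adj⇒down ab
    ... | inj₁ a↓b = inj₁ (down-decreasing a↓b)
    ... | inj₂ b↓a = inj₂ b↓a
    descends-or-ends-upward a b (c ∷ rest) (ab ∷ linked) noBt with adj⇒down ab
    ... | inj₂ b↓a = inj₂ (proj₂ (upward-stays-upward a b (c ∷ rest) (ab ∷ linked) noBt b↓a))
    ... | inj₁ a↓b with descends-or-ends-upward b c rest linked (proj₂ noBt)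
    ...   | inj₁ last<b = inj₁ (<-trans last<b (down-decreasing a↓b))
    ...   | inj₂ ends   = inj₂ ends

    NoBacktrack-∷ʳ : ∀ z a b rest → All (z ≢_) (a ∷ b ∷ rest) → Unique (a ∷ b ∷ rest) →
                     NoBacktrack ((a ∷ b ∷ rest) ∷ʳ z)
    NoBacktrack-∷ʳ z a b []         (z≢a ∷ _) _                    = (λ a≡z → z≢a (sym a≡z)) , tt
    NoBacktrack-∷ʳ z a b (c ∷ rest) (_ ∷ z≢s) ((_ ∷ a≢c ∷ _) ∷ u) = a≢c , NoBacktrack-∷ʳ z b c rest z≢s u

    EndsUpward-∷ʳ : ∀ a b rest z → EndsUpward a b (rest ∷ʳ z) → Down z (last b rest)
    EndsUpward-∷ʳ a b []         z up = up
    EndsUpward-∷ʳ a b (c ∷ rest) z up = EndsUpward-∷ʳ b c rest z up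

    ≢last : ∀ (x : Node) b rest → All (x ≢_) (b ∷ rest) → x ≢ last b rest
    ≢last x b []         (x≢b ∷ []) = x≢b
    ≢last x b (c ∷ rest) (_ ∷ x≢s)  = ≢last x c rest x≢s

    -- A walk that steps up keeps stepping up, since down-neighbours are unique and
    -- a cycle never backtracks; so either the heights rise back to the start, or they fall back to it, or the
    -- last step goes up into x₀ from a second down-neighbour of x₀.
    no-cycle : ∀ x₀ x₁ x₂ xs → Unique (x₀ ∷ x₁ ∷ x₂ ∷ xs) → Linked Adj (x₀ ∷ x₁ ∷ x₂ ∷ xs) →
               Adj (last x₂ xs) x₀ → ⊥
    no-cycle x₀ x₁ x₂ xs u linked closing with adj⇒down (Linked.head linked)
    ... | inj₂ x₁↓x₀ = <-irrefl (sym (cong height (last-∷ʳ x₁ (x₂ ∷ xs) x₀)))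
                         (proj₁ (upward-stays-upward x₀ x₁ (x₂ ∷ xs ∷ʳ x₀) closed noBt x₁↓x₀))
      where
      closed = Linked-∷ʳ x₀ (x₁ ∷ x₂ ∷ xs) x₀ linked closing
      noBt : NoBacktrack (x₀ ∷ x₁ ∷ x₂ ∷ (xs ∷ʳ x₀))
      noBt = All.head (All.tail (AllPairs.head u)) , NoBacktrack-∷ʳ x₀ x₁ x₂ xs (AllPairs.head u) (AllPairs.tail u)
    ... | inj₁ x₀↓x₁ with descends-or-ends-upward x₀ x₁ (x₂ ∷ xs ∷ʳ x₀) closed noBt
      where
      closed = Linked-∷ʳ x₀ (x₁ ∷ x₂ ∷ xs) x₀ linked closing
      noBt : NoBacktrack (x₀ ∷ x₁ ∷ x₂ ∷ (xs ∷ʳ x₀))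
      noBt = All.head (All.tail (AllPairs.head u)) , NoBacktrack-∷ʳ x₀ x₁ x₂ xs (AllPairs.head u) (AllPairs.tail u)
    ...   | inj₁ last<x₀ = <-irrefl (cong height (last-∷ʳ x₁ (x₂ ∷ xs) x₀)) last<x₀
    ...   | inj₂ ends    = ≢last x₁ x₂ xs (AllPairs.head (AllPairs.tail u))
                             (down-functional x₀↓x₁ (EndsUpward-∷ʳ x₁ x₂ xs x₀ ends))

  data Walk : Node → Node → List Node → Set where
    one  : ∀ {x} → Walk x x (x ∷ [])
    step : ∀ {x y z ps} → Adj x y → Walk y z ps → Walk x z (x ∷ ps)

  walk-∷ʳ : ∀ {x y z ps} → Walk x y ps → Adj y z → Walk x z (ps ∷ʳ z)
  walk-∷ʳ one           yz = step yz one
  walk-∷ʳ (step xy w)   yz = step xy (walk-∷ʳ w yz)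

  walk-linked : ∀ {x y ps} → Walk x y ps → Linked Adj ps
  walk-linked one                  = [-]
  walk-linked (step xy one)        = xy ∷ [-]
  walk-linked (step xy (step yz w)) = xy ∷ walk-linked (step yz w)

  walk-last : ∀ {x y a as} → Walk x y (a ∷ as) → last a as ≡ y
  walk-last one                  = refl
  walk-last (step _ one)         = refl
  walk-last (step _ (step yz w)) = walk-last (step yz w)

  -- Simple paths in a graph where every node except the root has a designated neighbour of smaller height
  -- (and the nodes of interest, In, are closed under going down): descend from whichever end is higher.
  module RootedPaths (adj-sym : ∀ {x y} → Adj x y → Adj y x)
                     (_≟_ : (x y : Node) → Dec (x ≡ y))
                     (height : Node → ℕ) (In : Node → Set) (root : Node) (height-root : height root ≡ 0)
                     (down : ∀ x → In x → x ≢ root → Node)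
                     (down-In : ∀ x p q → In (down x p q))
                     (down-adj : ∀ x p q → Adj x (down x p q))
                     (down-height : ∀ x p q → height (down x p q) < height x)
                     (Good : Node → Set) (down-good : ∀ x p q → Good (down x p q)) where

    Between : Node → Node → List Node → Set
    Between x y ps = All (λ w → height w ≤ height x ⊎ w ≡ y ⊎ height w < height y) ps

    root-or-positive : ∀ x → In x → 0 < height x ⊎ x ≡ root
    root-or-positive x p with x ≟ root
    ... | yes x≡root = inj₂ x≡root
    ... | no x≢root  = inj₁ (≤-<-trans z≤n (down-height x p x≢root))

    SimplePath : Node → Node → Set
    SimplePath x y = Σ (List Node) λ ps → Walk x y ps × Unique ps × All Good ps × Between x y ps

    prepend : ∀ {x x′ y} → Adj x x′ → height x′ < height x → height y ≤ height x → x ≢ y → Good x →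
              SimplePath x′ y → SimplePath x y
    prepend {x} {x′} {y} x—x′ x′<x hy≤hx x≢y gx (ps , w , u , g , between) =
      (x ∷ ps) , step x—x′ w , (All.map x≢ between ∷ u) , (gx ∷ g) , (inj₁ ≤-refl ∷ All.map widen between)
      where
      x≢ : ∀ {w} → height w ≤ height x′ ⊎ w ≡ y ⊎ height w < height y → x ≢ w
      x≢ (inj₁ hw≤hx′)       refl = <-irrefl refl (≤-<-trans hw≤hx′ x′<x)
      x≢ (inj₂ (inj₁ refl))  refl = x≢y refl
      x≢ (inj₂ (inj₂ hw<hy)) refl = <-irrefl refl (<-≤-trans hw<hy hy≤hx)
      widen : ∀ {w} → height w ≤ height x′ ⊎ w ≡ y ⊎ height w < height y →
              height w ≤ height x ⊎ w ≡ y ⊎ height w < height y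
      widen (inj₁ hw≤hx′) = inj₁ (≤-trans hw≤hx′ (<⇒≤ x′<x))
      widen (inj₂ w)      = inj₂ w

    append : ∀ {x y y′} → Adj y y′ → height y′ < height y → height x < height y → Good y →
             SimplePath x y′ → SimplePath x y
    append {x} {y} {y′} y—y′ y′<y hx<hy gy (ps , w , u , g , between) =
      (ps ∷ʳ y) , walk-∷ʳ w (adj-sym y—y′) ,
      AllPairs.++⁺ u ([] ∷ []) (All.map (λ b → ≢y b ∷ []) between) , All.++⁺ g (gy ∷ []) ,
      All.++⁺ (All.map widen between) (inj₂ (inj₁ refl) ∷ [])
      where
      ≢y : ∀ {w} → height w ≤ height x ⊎ w ≡ y′ ⊎ height w < height y′ → w ≢ y
      ≢y (inj₁ hw≤hx)         refl = <-irrefl refl (≤-<-trans hw≤hx hx<hy)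
      ≢y (inj₂ (inj₁ refl))   w≡y  = <-irrefl (cong height w≡y) y′<y
      ≢y (inj₂ (inj₂ hw<hy′)) refl = <-irrefl refl (<-trans hw<hy′ y′<y)
      widen : ∀ {w} → height w ≤ height x ⊎ w ≡ y′ ⊎ height w < height y′ →
              height w ≤ height x ⊎ w ≡ y ⊎ height w < height y
      widen (inj₁ hw≤hx)         = inj₁ hw≤hx
      widen (inj₂ (inj₁ refl))   = inj₂ (inj₂ y′<y)
      widen (inj₂ (inj₂ hw<hy′)) = inj₂ (inj₂ (<-trans hw<hy′ y′<y))

    simplePath : ∀ fuel x y → In x → In y → Good x → Good y → height x + height y < fuel → SimplePath x y
    simplePath (suc fuel) x y px py gx gy lt with x ≟ y
    ... | yes refl = (x ∷ []) , one , ([] ∷ []) , (gx ∷ []) , (inj₁ ≤-refl ∷ [])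
    ... | no x≢y with height y ≤? height x
    ...   | yes hy≤hx = prepend (down-adj x px x≢root) x′<x hy≤hx x≢y gx
                          (simplePath fuel (down x px x≢root) y (down-In x px x≢root) py (down-good x px x≢root) gy
                             (<-≤-trans (+-monoˡ-< (height y) x′<x) (s≤s⁻¹ lt)))
      where
      x≢root : x ≢ root
      x≢root x≡root with root-or-positive y py
      ... | inj₁ pos    = <-irrefl refl (<-≤-trans pos (≤-trans hy≤hx (≤-reflexive (trans (cong height x≡root) height-root))))
      ... | inj₂ y≡root = x≢y (trans x≡root (sym y≡root))
      x′<x = down-height x px x≢root
    ...   | no hy≰hx = append (down-adj y py y≢root) y′<y hx<hy gy
                         (simplePath fuel x (down y py y≢root) px (down-In y py y≢root) gx (down-good y py y≢root)
                            (<-≤-trans (+-monoʳ-< (height x) y′<y) (s≤s⁻¹ lt)))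
      where
      hx<hy : height x < height y
      hx<hy = ≰⇒> hy≰hx
      y≢root : y ≢ root
      y≢root y≡root = <-irrefl refl (<-≤-trans hx<hy (≤-trans (≤-reflexive (trans (cong height y≡root) height-root)) z≤n))
      y′<y = down-height y py y≢root


module UniqueLists where

  open import Data.List using (List; []; _∷_; _++_; lookup)
  open import Data.Fin using (zero; suc)
  open import Data.List.Membership.Propositional using (_∈_; _∉_)
  import Data.List.Membership.Propositional.Properties as LMP
  open import Data.List.Relation.Unary.Any using (here; there)
  open import Data.List.Relation.Unary.All as All using (All; []; _∷_)
  open import Data.List.Relation.Unary.AllPairs using ([]; _∷_)
  open import Data.List.Relation.Unary.Unique.Propositional using (Unique)
  open import Data.List.Relation.Binary.Permutation.Propositional
  open import Data.List.Relation.Binary.Permutation.Propositional.Properties using (shift)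
  open import Data.Product
  open import Data.Sum
  open import Data.Empty
  open import Relation.Nullary
  import Relation.Binary.PropositionalEquality as Eq

  module _ {A : Set} where

    ∈-++-insert : ∀ (ws : List A) {x z zs} → z ∈ ws ++ zs → z ∈ ws ++ x ∷ zs
    ∈-++-insert []       z∈        = there z∈
    ∈-++-insert (w ∷ ws) (here e)  = here e
    ∈-++-insert (w ∷ ws) (there m) = there (∈-++-insert ws m)

    Unique-remove : ∀ (ys : List A) {x zs} → Unique (ys ++ x ∷ zs) → Unique (ys ++ zs) × x ∉ ys ++ zs
    Unique-remove []       (x∉ ∷ u) = u , λ x∈ → All.lookup x∉ x∈ Eq.refl
    Unique-remove (y ∷ ys) (y∉ ∷ u) =
      let u′ , x∉ = Unique-remove ys u
      in  All.tabulate (λ z∈ → All.lookup y∉ (∈-++-insert ys z∈)) ∷ u′ ,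
          λ { (here x≡y) → All.lookup y∉ (LMP.∈-++⁺ʳ ys (here Eq.refl)) (Eq.sym x≡y) ; (there x∈) → x∉ x∈ }

    Unique-sameElements⇒↭ : ∀ {xs ys : List A} → Unique xs → Unique ys →
                            (∀ z → z ∈ xs → z ∈ ys) → (∀ z → z ∈ ys → z ∈ xs) → xs ↭ ys
    Unique-sameElements⇒↭ {[]} {[]}     _ _ _ _ = refl
    Unique-sameElements⇒↭ {[]} {y ∷ ys} _ _ _ ys⊆ with () ← ys⊆ y (here Eq.refl)
    Unique-sameElements⇒↭ {x ∷ xs} {ys} (x∉ ∷ uxs) uys xs⊆ ys⊆ with LMP.∈-∃++ (xs⊆ x (here Eq.refl))
    ... | ys₁ , ys₂ , Eq.refl =
      trans (prep x (Unique-sameElements⇒↭ uxs (proj₁ removed) xs⊆′ ys⊆′)) (↭-sym (shift x ys₁ ys₂))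
      where
      removed = Unique-remove ys₁ uys
      xs⊆′ : ∀ z → z ∈ xs → z ∈ ys₁ ++ ys₂
      xs⊆′ z z∈ with LMP.∈-++⁻ ys₁ (xs⊆ z (there z∈))
      ... | inj₁ z∈ys₁         = LMP.∈-++⁺ˡ z∈ys₁
      ... | inj₂ (here z≡x)    = ⊥-elim (All.lookup x∉ z∈ (Eq.sym z≡x))
      ... | inj₂ (there z∈ys₂) = LMP.∈-++⁺ʳ ys₁ z∈ys₂
      ys⊆′ : ∀ z → z ∈ ys₁ ++ ys₂ → z ∈ xs
      ys⊆′ z z∈ with ys⊆ z (∈-++-insert ys₁ z∈)
      ... | here Eq.refl = ⊥-elim (proj₂ removed z∈)
      ... | there z∈xs   = z∈xs

    Unique⇒lookup-injective : ∀ {xs : List A} → Unique xs → ∀ i j → lookup xs i Eq.≡ lookup xs j → i Eq.≡ j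
    Unique⇒lookup-injective {xs = x ∷ xs} (h ∷ u) zero zero e = Eq.refl
    Unique⇒lookup-injective {xs = x ∷ xs} (h ∷ u) zero (suc j) e = ⊥-elim (All.lookup h (LMP.∈-lookup j) e)
    Unique⇒lookup-injective {xs = x ∷ xs} (h ∷ u) (suc i) zero e = ⊥-elim (All.lookup h (LMP.∈-lookup i) (Eq.sym e))
    Unique⇒lookup-injective {xs = x ∷ xs} (h ∷ u) (suc i) (suc j) e = Eq.cong suc (Unique⇒lookup-injective u i j e)


module Subsets where

  open import Data.Nat as ℕ using (ℕ; zero; suc; _≤_; _<_; s≤s; z≤n)
  import Data.Nat.Properties as ℕP
  open import Data.Bool using (true; false)
  open import Data.Fin as F using (Fin; zero; suc; fromℕ; inject₁)
  import Data.Fin.Properties as FP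
  open import Data.Fin.Subset
  open import Data.Fin.Subset.Properties
  open import Data.Vec as V using ([]; _∷_; _∷ʳ_; lookup; init)
  import Data.Vec.Properties as VP
  open import Data.List as L using (List; length; map) renaming ([] to []L; _∷_ to _∷L_)
  import Data.List.Properties as LP
  import Data.List.Membership.Propositional as LM
  import Data.List.Membership.Propositional.Properties as LMP
  open import Data.List.Relation.Unary.Any using (here; there)
  import Data.List.Relation.Unary.All as All
  import Data.List.Relation.Unary.AllPairs as AP
  open import Data.List.Relation.Unary.Unique.Propositional using (Unique)
  import Data.List.Relation.Unary.Unique.Propositional.Properties as UP
  open import Data.Product hiding (map)
  open import Data.Sum hiding (map)
  open import Data.Empty renaming (⊥ to Empty)
  open import Relation.Nullary
  open import Relation.Nullary.Decidable using (_⊎-dec_; _×-dec_; ¬?)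
  open import Relation.Binary.PropositionalEquality
  open Counting

  ∈⇒lookup≡true : ∀ {n} {x : Fin n} {p} → x ∈ p → lookup p x ≡ true
  ∈⇒lookup≡true = VP.[]=⇒lookup

  lookup≡true⇒∈ : ∀ {n} {x : Fin n} {p} → lookup p x ≡ true → x ∈ p
  lookup≡true⇒∈ {x = x} {p} = VP.lookup⇒[]= x p

  ∉⇒lookup≡false : ∀ {n} {x : Fin n} {p} → x ∉ p → lookup p x ≡ false
  ∉⇒lookup≡false {x = x} {p} h with lookup p x in e
  ... | true = ⊥-elim (h (lookup≡true⇒∈ e))
  ... | false = refl

  subset-ext : ∀ {n} {p q : Subset n} → (∀ x → x ∈ p → x ∈ q) → (∀ x → x ∈ q → x ∈ p) → p ≡ q
  subset-ext f g = ⊆-antisym (λ {x} → f x) (λ {x} → g x)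

  x∈p─q⁻ : ∀ {n} {x : Fin n} p q → x ∈ p ─ q → x ∈ p × x ∉ q
  x∈p─q⁻ p q h = p─q⊆p p q h , notq p q h
    where
    notq : ∀ {n} {x : Fin n} p q → x ∈ p ─ q → x ∉ q
    notq {x = zero} (a ∷ p) (true ∷ q) ()
    notq {x = zero} (a ∷ p) (false ∷ q) h ()
    notq {x = suc x} (a ∷ p) (b ∷ q) (V.there h) (V.there h′) = notq p q h h′

  x∈p-y⁻ : ∀ {n} {x : Fin n} p y → x ∈ p - y → x ∈ p × x ≢ y
  x∈p-y⁻ p y h = let (a , b) = x∈p─q⁻ p ⁅ y ⁆ h in a , λ e → b (subst (_∈ ⁅ y ⁆) (sym e) (x∈⁅x⁆ y))

  ∈⁅⁆⇒≡ : ∀ {n} {x y : Fin n} → x ∈ ⁅ y ⁆ → x ≡ y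
  ∈⁅⁆⇒≡ {y = y} = x∈⁅y⁆⇒x≡y y

  x∈⋃⁻ : ∀ {n} {x : Fin n} (bs : List (Subset n)) → x ∈ ⋃ bs → ∃ λ b → b LM.∈ bs × x ∈ b
  x∈⋃⁻ []L h = ⊥-elim (∉⊥ h)
  x∈⋃⁻ (b ∷L bs) h with x∈p∪q⁻ b (⋃ bs) h
  ... | inj₁ a = b , here refl , a
  ... | inj₂ a = let (c , m , xc) = x∈⋃⁻ bs a in c , there m , xc

  x∈⋃⁺ : ∀ {n} {x : Fin n} {b} (bs : List (Subset n)) → b LM.∈ bs → x ∈ b → x ∈ ⋃ bs
  x∈⋃⁺ (c ∷L bs) (here refl) xb = x∈p∪q⁺ (inj₁ xb)
  x∈⋃⁺ (c ∷L bs) (there m) xb = x∈p∪q⁺ (inj₂ (x∈⋃⁺ bs m xb))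

  ∣p∣≡count : ∀ {n} (p : Subset n) → ∣ p ∣ ≡ count (λ i → i ∈? p)
  ∣p∣≡count [] = refl
  ∣p∣≡count (true ∷ p)  = cong suc (trans (∣p∣≡count p)
                            (count-cong (λ i → i ∈? p) (λ i → suc i ∈? (true ∷ p)) (λ i → V.there) (λ i → drop-there)))
  ∣p∣≡count (false ∷ p) = trans (∣p∣≡count p)
                            (count-cong (λ i → i ∈? p) (λ i → suc i ∈? (false ∷ p)) (λ i → V.there) (λ i → drop-there))

  count≡∣p∣ : ∀ {n} (p : Subset n) {P : Fin n → Set} (dP : ∀ i → Dec (P i)) →
              (∀ i → P i → i ∈ p) → (∀ i → i ∈ p → P i) → count dP ≡ ∣ p ∣
  count≡∣p∣ p dP f g = trans (count-cong dP (λ i → i ∈? p) f g) (sym (∣p∣≡count p))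

  ∣p∪q∣≡∣p∣+∣q∣ : ∀ {n} (p q : Subset n) → (∀ i → i ∈ p → i ∉ q) → ∣ p ∪ q ∣ ≡ ∣ p ∣ ℕ.+ ∣ q ∣
  ∣p∪q∣≡∣p∣+∣q∣ p q disjoint = begin
    ∣ p ∪ q ∣                               ≡⟨ sym (count≡∣p∣ (p ∪ q) (λ i → (i ∈? p) ⊎-dec (i ∈? q))
                                                         (λ i → x∈p∪q⁺) (λ i → x∈p∪q⁻ p q)) ⟩
    count (λ i → (i ∈? p) ⊎-dec (i ∈? q))   ≡⟨ count-⊎ (_∈? p) (_∈? q) disjoint ⟩
    count (_∈? p) ℕ.+ count (_∈? q)          ≡⟨ sym (cong₂ ℕ._+_ (∣p∣≡count p) (∣p∣≡count q)) ⟩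
    ∣ p ∣ ℕ.+ ∣ q ∣                          ∎
    where open ≡-Reasoning

  ∣p∪⁅x⁆∣≡1+∣p∣ : ∀ {n} (A : Subset n) v → v ∉ A → ∣ A ∪ ⁅ v ⁆ ∣ ≡ suc ∣ A ∣
  ∣p∪⁅x⁆∣≡1+∣p∣ A v v∉A = trans (∣p∪q∣≡∣p∣+∣q∣ A ⁅ v ⁆ λ i i∈A i∈⁅v⁆ → v∉A (subst (_∈ A) (∈⁅⁆⇒≡ i∈⁅v⁆) i∈A))
                            (trans (cong (∣ A ∣ ℕ.+_) (∣⁅x⁆∣≡1 v)) (ℕP.+-comm ∣ A ∣ 1))

  ∣p∣≡1⇒singleton : ∀ {n} (A : Subset n) → ∣ A ∣ ≡ 1 → ∃ λ v → A ≡ ⁅ v ⁆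
  ∣p∣≡1⇒singleton A e = v , subset-ext to (λ x h → subst (_∈ A) (sym (∈⁅⁆⇒≡ h)) vA)
    where
    w = count>0⇒∃ (λ i → i ∈? A) (subst (0 <_) (∣p∣≡count A) (subst (0 <_) (sym e) (s≤s z≤n)))
    v = proj₁ w
    vA = proj₂ w
    to : ∀ x → x ∈ A → x ∈ ⁅ v ⁆
    to x xA with x FP.≟ v
    ... | yes refl = x∈⁅x⁆ v
    ... | no ne = ⊥-elim (ℕP.<-irrefl (trans (count-≡ v) (trans (sym e) (∣p∣≡count A)))
                    (count-mono-< (λ i → i FP.≟ v) (λ i → i ∈? A) (λ i e′ → subst (_∈ A) (sym e′) vA) x xA ne))

  ∣p∣≥2⇒two-elements : ∀ {n} (A : Subset n) → 2 ≤ ∣ A ∣ → ∃₂ λ x y → x ∈ A × y ∈ A × x ≢ y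
  ∣p∣≥2⇒two-elements A 2≤∣A∣
    with count>0⇒∃ (λ i → i ∈? A) (subst (0 <_) (∣p∣≡count A) (ℕP.<-≤-trans (s≤s z≤n) 2≤∣A∣))
  ... | x , x∈A with FP.any? (λ y → (y ∈? A) ×-dec ¬? (y FP.≟ x))
  ...   | yes (y , y∈A , y≢x) = x , y , x∈A , y∈A , λ x≡y → y≢x (sym x≡y)
  ...   | no none = ⊥-elim (ℕP.<⇒≱ 2≤∣A∣ (ℕP.≤-trans (p⊆q⇒∣p∣≤∣q∣ A⊆⁅x⁆) (ℕP.≤-reflexive (∣⁅x⁆∣≡1 x))))
    where
    A⊆⁅x⁆ : A ⊆ ⁅ x ⁆
    A⊆⁅x⁆ {y} y∈A with y FP.≟ x
    ... | yes refl = x∈⁅x⁆ x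
    ... | no y≢x   = ⊥-elim (none (y , y∈A , y≢x))

  extend : ∀ {m} → Subset m → Subset (suc m)
  extend b = b ∷ʳ false

  lookup-∷ʳ-inject₁ : ∀ {m} (b : Subset m) x a → lookup (b ∷ʳ x) (inject₁ a) ≡ lookup b a
  lookup-∷ʳ-inject₁ (y ∷ b) x zero = refl
  lookup-∷ʳ-inject₁ (y ∷ b) x (suc a) = lookup-∷ʳ-inject₁ b x a

  lookup-∷ʳ-fromℕ : ∀ {m} (b : Subset m) x → lookup (b ∷ʳ x) (fromℕ m) ≡ x
  lookup-∷ʳ-fromℕ [] x = refl
  lookup-∷ʳ-fromℕ (y ∷ b) x = lookup-∷ʳ-fromℕ b x

  ∈extend⁺ : ∀ {m} {a : Fin m} {b} → a ∈ b → inject₁ a ∈ extend b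
  ∈extend⁺ {a = a} {b} h = lookup≡true⇒∈ (trans (lookup-∷ʳ-inject₁ b false a) (∈⇒lookup≡true h))

  ∈extend⁻ : ∀ {m} {a : Fin m} {b} → inject₁ a ∈ extend b → a ∈ b
  ∈extend⁻ {a = a} {b} h = lookup≡true⇒∈ (trans (sym (lookup-∷ʳ-inject₁ b false a)) (∈⇒lookup≡true h))

  fromℕ∉extend : ∀ {m} (b : Subset m) → fromℕ m ∉ extend b
  fromℕ∉extend b h with () ← trans (sym (lookup-∷ʳ-fromℕ b false)) (∈⇒lookup≡true h)

  fromℕ-or-inject₁ : ∀ {m} (x : Fin (suc m)) → x ≡ fromℕ m ⊎ ∃ λ a → x ≡ inject₁ a
  fromℕ-or-inject₁ {zero} zero = inj₁ refl
  fromℕ-or-inject₁ {suc m} zero = inj₂ (zero , refl)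
  fromℕ-or-inject₁ {suc m} (suc x) with fromℕ-or-inject₁ x
  ... | inj₁ e = inj₁ (cong suc e)
  ... | inj₂ (a , e) = inj₂ (suc a , cong suc e)

  inject₁≢fromℕ : ∀ {m} (a : Fin m) → inject₁ a ≢ fromℕ m
  inject₁≢fromℕ a e = FP.fromℕ≢inject₁ (sym e)

  init-extend : ∀ {m} (b : Subset m) → init (extend b) ≡ b
  init-extend b = VP.init-∷ʳ false b

  fromℕ∉⇒≡extend : ∀ {m} (c : Subset (suc m)) → fromℕ m ∉ c → c ≡ extend (init c)
  fromℕ∉⇒≡extend {m} c h = trans (proj₂ (proj₂ (V.initLast c))) (cong (init c ∷ʳ_) lastF)
    where
    lastF : V.last c ≡ false
    lastF = trans (sym (lookup-∷ʳ-fromℕ (init c) (V.last c)))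
                  (trans (cong (λ z → lookup z (fromℕ m)) (sym (proj₂ (proj₂ (V.initLast c))))) (∉⇒lookup≡false h))

  ∣extend∣ : ∀ {m} (b : Subset m) → ∣ extend b ∣ ≡ ∣ b ∣
  ∣extend∣ [] = refl
  ∣extend∣ (true ∷ b) = cong suc (∣extend∣ b)
  ∣extend∣ (false ∷ b) = ∣extend∣ b

  ∈extend-inject₁ : ∀ {m} {x : Fin (suc m)} {b} → x ∈ extend b → ∃ λ a → x ≡ inject₁ a × a ∈ b
  ∈extend-inject₁ {x = x} {b} h with fromℕ-or-inject₁ x
  ... | inj₁ refl = ⊥-elim (fromℕ∉extend b h)
  ... | inj₂ (a , refl) = a , refl , ∈extend⁻ h

  elements : ∀ {n} → Subset n → List (Fin n)
  elements [] = []L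
  elements (true ∷ p) = zero ∷L map suc (elements p)
  elements (false ∷ p) = map suc (elements p)

  length-elements : ∀ {n} (p : Subset n) → length (elements p) ≡ ∣ p ∣
  length-elements [] = refl
  length-elements (true ∷ p) = cong suc (trans (LP.length-map suc (elements p)) (length-elements p))
  length-elements (false ∷ p) = trans (LP.length-map suc (elements p)) (length-elements p)

  ∈elements⁺ : ∀ {n} {x : Fin n} {p} → x ∈ p → x LM.∈ elements p
  ∈elements⁺ {x = zero} {true ∷ p} V.here = here refl
  ∈elements⁺ {x = suc x} {true ∷ p} (V.there h) = there (LMP.∈-map⁺ suc (∈elements⁺ h))
  ∈elements⁺ {x = suc x} {false ∷ p} (V.there h) = LMP.∈-map⁺ suc (∈elements⁺ h)

  ∈elements⁻ : ∀ {n} {x : Fin n} {p} → x LM.∈ elements p → x ∈ p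
  ∈elements⁻ {x = zero} {true ∷ p} h = V.here
  ∈elements⁻ {x = suc x} {true ∷ p} (there h) with LMP.∈-map⁻ suc h
  ... | (y , yp , e) = V.there (subst (_∈ p) (sym (FP.suc-injective e)) (∈elements⁻ yp))
  ∈elements⁻ {x = zero} {false ∷ p} h with LMP.∈-map⁻ suc h
  ... | (y , yp , ())
  ∈elements⁻ {x = suc x} {false ∷ p} h with LMP.∈-map⁻ suc h
  ... | (y , yp , e) = V.there (subst (_∈ p) (sym (FP.suc-injective e)) (∈elements⁻ yp))

  elements-unique : ∀ {n} (p : Subset n) → Unique (elements p)
  elements-unique [] = AP.[]
  elements-unique (true ∷ p) = All.tabulate (λ {y} h e → znot (subst (LM._∈ map suc (elements p)) (sym e) h)) AP.∷
                               UP.map⁺ FP.suc-injective (elements-unique p)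
    where
    znot : zero LM.∉ map suc (elements p)
    znot h with LMP.∈-map⁻ suc h
    ... | (_ , _ , ())
  elements-unique (false ∷ p) = UP.map⁺ FP.suc-injective (elements-unique p)


module Blocks (R m : ℕ) (M : List (Subset m)) (pm : IsPerfectMatching R m M) where

  open import Data.Nat as ℕ using (zero; suc; _+_; _*_)
  import Data.Nat.Properties as ℕP
  open import Data.Fin as F using (Fin; zero; suc; fromℕ; inject₁; toℕ; cast)
  import Data.Fin.Properties as FP
  open import Data.Fin.Subset
  open import Data.Fin.Subset.Properties
  open import Data.List as L using (length; lookup) renaming ([] to []L; _∷_ to _∷L_)
  import Data.List.Membership.Propositional as LM
  import Data.List.Membership.Propositional.Properties as LMP
  import Data.List.Relation.Unary.Any as Any
  import Data.List.Relation.Unary.Any.Properties as AnyP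
  open import Data.List.Relation.Unary.All as All using (All)
  open import Data.Maybe using (Maybe; just; nothing)
  open import Data.Product hiding (map)
  open import Data.Sum hiding (map)
  open import Data.Empty renaming (⊥ to ⊥e)
  open import Relation.Nullary
  open import Relation.Binary.PropositionalEquality
  open Counting
  open Subsets
  open UniqueLists using (Unique⇒lookup-injective)

  K : ℕ
  K = length M

  blockOf : Fin m → Fin K
  blockOf a = proj₁ (proj₂ pm a)

  ∈blockOf : ∀ a → a ∈ lookup M (blockOf a)
  ∈blockOf a = proj₁ (proj₂ (proj₂ pm a))

  blockOf-unique : ∀ {a j} → a ∈ lookup M j → j ≡ blockOf a
  blockOf-unique {a} {j} h = proj₂ (proj₂ (proj₂ pm a)) j h

  ∣block∣≡R : ∀ j → ∣ lookup M j ∣ ≡ R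
  ∣block∣≡R j = All.lookup (proj₁ pm) (LMP.∈-lookup j)

  length-elements-block : ∀ j → length (elements (lookup M j)) ≡ R
  length-elements-block j = trans (length-elements (lookup M j)) (∣block∣≡R j)

  element : Fin K → Fin R → Fin m
  element j i = lookup (elements (lookup M j)) (cast (sym (length-elements-block j)) i)

  element∈block : ∀ j i → element j i ∈ lookup M j
  element∈block j i = ∈elements⁻ (LMP.∈-lookup (cast (sym (length-elements-block j)) i))

  blockOf-element : ∀ j i → blockOf (element j i) ≡ j
  blockOf-element j i = sym (blockOf-unique (element∈block j i))

  position : Fin m → Fin R
  position a = cast (length-elements-block (blockOf a)) (Any.index (∈elements⁺ (∈blockOf a)))

  element-position : ∀ a → element (blockOf a) (position a) ≡ a
  element-position a =
    trans (cong (lookup (elements (lookup M (blockOf a))))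
                (FP.cast-involutive (sym (length-elements-block (blockOf a))) (length-elements-block (blockOf a)) _))
          (sym (AnyP.lookup-index (∈elements⁺ (∈blockOf a))))

  position-element : ∀ j i → position (element j i) ≡ i
  position-element j i =
    FP.toℕ-injective (trans (FP.toℕ-cast (length-elements-block (blockOf (element j i))) _)
                            (index-of-element (blockOf (element j i)) (blockOf-element j i) (∈elements⁺ (∈blockOf (element j i)))))
    where
    index-of-element : ∀ j′ → j′ ≡ j → (p : element j i LM.∈ elements (lookup M j′)) → toℕ (Any.index p) ≡ toℕ i
    index-of-element j′ refl p = trans (cong toℕ (Unique⇒lookup-injective (elements-unique (lookup M j)) (Any.index p)
                                       (cast (sym (length-elements-block j)) i) (sym (AnyP.lookup-index p))))
                          (FP.toℕ-cast (sym (length-elements-block j)) i)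

  vertex : Maybe (Fin K × Fin R) → Fin (suc m)
  vertex nothing = fromℕ m
  vertex (just (j , i)) = inject₁ (element j i)

  address : Fin (suc m) → Maybe (Fin K × Fin R)
  address x with fromℕ-or-inject₁ x
  ... | inj₁ _ = nothing
  ... | inj₂ (a , _) = just (blockOf a , position a)

  address-inject₁ : ∀ a → address (inject₁ a) ≡ just (blockOf a , position a)
  address-inject₁ a with fromℕ-or-inject₁ (inject₁ a)
  ... | inj₁ e = ⊥-elim (inject₁≢fromℕ a e)
  ... | inj₂ (a′ , e) with FP.inject₁-injective e
  ... | refl = refl

  address-fromℕ : address (fromℕ m) ≡ nothing
  address-fromℕ with fromℕ-or-inject₁ (fromℕ m)
  ... | inj₁ _ = refl
  ... | inj₂ (a , e) = ⊥-elim (inject₁≢fromℕ a (sym e))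

  vertex-address : ∀ x → vertex (address x) ≡ x
  vertex-address x with fromℕ-or-inject₁ x
  ... | inj₁ e = sym e
  ... | inj₂ (a , e) = trans (cong inject₁ (element-position a)) (sym e)

  address-vertex : ∀ p → address (vertex p) ≡ p
  address-vertex nothing = address-fromℕ
  address-vertex (just (j , i)) = trans (address-inject₁ (element j i)) (cong just (cong₂ _,_ (blockOf-element j i) (position-element j i)))

  sumSizes : List (Subset m) → ℕ
  sumSizes []L = 0
  sumSizes (b ∷L Bs) = ∣ b ∣ + sumSizes Bs

  ∣⋃∣≡sumSizes : ∀ (Bs : List (Subset m)) → (∀ a (i j : Fin (length Bs)) → a ∈ lookup Bs i → a ∈ lookup Bs j → i ≡ j) →
            ∣ ⋃ Bs ∣ ≡ sumSizes Bs
  ∣⋃∣≡sumSizes []L h = ∣⊥∣≡0 m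
  ∣⋃∣≡sumSizes (b ∷L Bs) h =
    trans (∣p∪q∣≡∣p∣+∣q∣ b (⋃ Bs) disj)
          (cong (∣ b ∣ +_) (∣⋃∣≡sumSizes Bs (λ a i j x y → FP.suc-injective (h a (suc i) (suc j) x y))))
    where
    disj : ∀ a → a ∈ b → a ∈ ⋃ Bs → ⊥e
    disj a ab aU with x∈⋃⁻ Bs aU
    ... | (c , cm , ac) with h a zero (suc (Any.index cm)) ab (subst (a ∈_) (AnyP.lookup-index cm) ac)
    ... | ()

  sumSizes≡length*R : ∀ (Bs : List (Subset m)) → All (λ b → ∣ b ∣ ≡ R) Bs → sumSizes Bs ≡ length Bs * R
  sumSizes≡length*R []L _ = refl
  sumSizes≡length*R (b ∷L Bs) (e All.∷ a) = cong₂ _+_ e (sumSizes≡length*R Bs a)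

  R*K≡m : R * K ≡ m
  R*K≡m = begin
      R * K ≡⟨ ℕP.*-comm R K ⟩
      K * R ≡⟨ sym (sumSizes≡length*R M (proj₁ pm)) ⟩
      sumSizes M ≡⟨ sym (∣⋃∣≡sumSizes M uniqPos) ⟩
      ∣ ⋃ M ∣ ≡⟨ cong ∣_∣ U≡⊤ ⟩
      ∣ ⊤ {m} ∣ ≡⟨ ∣⊤∣≡n m ⟩
      m ∎
    where
    open ≡-Reasoning
    uniqPos : ∀ a (i j : Fin K) → a ∈ lookup M i → a ∈ lookup M j → i ≡ j
    uniqPos a i j x y = trans (blockOf-unique x) (sym (blockOf-unique y))
    U≡⊤ : ⋃ M ≡ ⊤
    U≡⊤ = subset-ext (λ x _ → ∈⊤) (λ x _ → x∈⋃⁺ M (LMP.∈-lookup (blockOf x)) (∈blockOf x))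


module MatchingRounds where

  open import Data.Nat using (ℕ; zero; suc; _≟_)
  open import Data.Bool using (T; T?)
  open import Data.Unit using (tt)
  open import Data.Fin using (Fin; fromℕ)
  open import Data.Fin.Subset using (Subset; _∈_; _∉_; ∣_∣; _∩_; _∪_; _─_; _-_; ⋃)
  open import Data.Fin.Subset.Properties using (_∈?_)
  open import Data.List using (List; _++_; map; filter; partition)
  open import Data.List.Properties using (partition-defn)
  open import Data.List.Membership.Propositional using () renaming (_∈_ to _∈L_)
  open import Data.List.Membership.Propositional.Properties using (∈-filter⁻; ∈-filter⁺; ∈-map⁻; ∈-map⁺)
  open import Data.Product using (∃; _×_; _,_; proj₁; proj₂)
  open import Data.Empty using (⊥-elim)
  open import Relation.Nullary using (Dec; yes; no)
  open import Relation.Unary.Properties using (∁?)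
  open import Relation.Binary.PropositionalEquality
  open import Defs

  module _ {m : ℕ} where

    oneMatched⇒ : (S e : Subset (suc m)) → T (oneMatched S e) → ∣ e ∩ S ∣ ≡ 1
    oneMatched⇒ S e one with ∣ e ∩ S ∣ ≟ 1
    ... | yes ≡1 = ≡1
    ... | no _   = ⊥-elim one

    oneMatched⇐ : (S e : Subset (suc m)) → ∣ e ∩ S ∣ ≡ 1 → T (oneMatched S e)
    oneMatched⇐ S e ≡1 with ∣ e ∩ S ∣ ≟ 1
    ... | yes _ = tt
    ... | no ≢1 = ≢1 ≡1

    containsSpecial⇒ : (e : Subset (suc m)) → T (containsSpecial e) → fromℕ m ∈ e
    containsSpecial⇒ e contains with fromℕ m ∈? e
    ... | yes ∈e = ∈e
    ... | no _   = ⊥-elim contains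

    containsSpecial⇐ : (e : Subset (suc m)) → fromℕ m ∈ e → T (containsSpecial e)
    containsSpecial⇐ e ∈e with fromℕ m ∈? e
    ... | yes _ = tt
    ... | no ∉e = ∉e ∈e

    State : Set
    State = Subset (suc m) × List (Subset (suc m)) × List (Subset (suc m))

    iterate-suc : ∀ t (s : State) → iterate (suc t) s ≡ round (iterate t s)
    iterate-suc zero    s = refl
    iterate-suc (suc t) s = iterate-suc t (round s)

    partition-proj₁ : ∀ {P : Subset (suc m) → Set} (P? : ∀ e → Dec (P e)) xs → proj₁ (partition P? xs) ≡ filter P? xs
    partition-proj₁ P? xs = cong proj₁ (partition-defn P? xs)

    partition-proj₂ : ∀ {P : Subset (suc m) → Set} (P? : ∀ e → Dec (P e)) xs → proj₂ (partition P? xs) ≡ filter (∁? P?) xs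
    partition-proj₂ P? xs = cong proj₂ (partition-defn P? xs)

    -- The state of the computation of μ E after t rounds; μ E is map init (found (length E)).
    module Run (E : List (Subset (suc m))) where

      sp : Fin (suc m)
      sp = fromℕ m

      containsSpecial? : ∀ e → Dec (T (containsSpecial {m} e))
      containsSpecial? e = T? (containsSpecial {m} e)

      oneMatched? : (S : Subset (suc m)) → ∀ e → Dec (T (oneMatched {m} S e))
      oneMatched? S e = T? (oneMatched S e)

      found₀ : List (Subset (suc m))
      found₀ = map (λ e → e - sp) (proj₁ (partition containsSpecial? E))

      state : ℕ → State
      state t = iterate t (⋃ found₀ , proj₂ (partition containsSpecial? E) , found₀)

      matched : ℕ → Subset (suc m)
      matched t = proj₁ (state t)

      unused : ℕ → List (Subset (suc m))
      unused t = proj₁ (proj₂ (state t))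

      found : ℕ → List (Subset (suc m))
      found t = proj₂ (proj₂ (state t))

      new : ℕ → List (Subset (suc m))
      new t = map (λ e → e ─ matched t) (proj₁ (partition (oneMatched? (matched t)) (unused t)))

      matched-suc : ∀ t → matched (suc t) ≡ matched t ∪ ⋃ (new t)
      matched-suc t = cong proj₁ (iterate-suc t (state 0))

      found-suc : ∀ t → found (suc t) ≡ found t ++ new t
      found-suc t = cong (λ s → proj₂ (proj₂ s)) (iterate-suc t (state 0))

      unused-suc : ∀ t → unused (suc t) ≡ filter (∁? (oneMatched? (matched t))) (unused t)
      unused-suc t = trans (cong (λ s → proj₁ (proj₂ s)) (iterate-suc t (state 0)))
                           (partition-proj₂ (oneMatched? (matched t)) (unused t))

      ∈unused₀⁻ : ∀ {e} → e ∈L unused 0 → e ∈L E × sp ∉ e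
      ∈unused₀⁻ {e} e∈ =
        let e∈T , ¬special = ∈-filter⁻ (∁? containsSpecial?) (subst (e ∈L_) (partition-proj₂ containsSpecial? E) e∈)
        in  e∈T , λ sp∈e → ¬special (containsSpecial⇐ e sp∈e)

      ∈unused₀⁺ : ∀ {e} → e ∈L E → sp ∉ e → e ∈L unused 0
      ∈unused₀⁺ {e} e∈T sp∉e = subst (e ∈L_) (sym (partition-proj₂ containsSpecial? E))
                                 (∈-filter⁺ (∁? containsSpecial?) e∈T λ special → sp∉e (containsSpecial⇒ e special))

      ∈found₀⁻ : ∀ {b} → b ∈L found 0 → ∃ λ e → e ∈L E × sp ∈ e × b ≡ e - sp
      ∈found₀⁻ b∈ with ∈-map⁻ (λ e → e - sp) b∈
      ... | e , e∈ , refl =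
        let e∈T , special = ∈-filter⁻ containsSpecial? (subst (e ∈L_) (partition-proj₁ containsSpecial? E) e∈)
        in  e , e∈T , containsSpecial⇒ e special , refl

      ∈found₀⁺ : ∀ {e} → e ∈L E → sp ∈ e → (e - sp) ∈L found 0
      ∈found₀⁺ {e} e∈T sp∈e = ∈-map⁺ (λ e → e - sp) (subst (e ∈L_) (sym (partition-proj₁ containsSpecial? E))
                                                      (∈-filter⁺ containsSpecial? e∈T (containsSpecial⇐ e sp∈e)))

      ∈unused-suc⁻ : ∀ t {e} → e ∈L unused (suc t) → e ∈L unused t × ∣ e ∩ matched t ∣ ≢ 1
      ∈unused-suc⁻ t {e} e∈ =
        let e∈unused , ¬one = ∈-filter⁻ (∁? (oneMatched? (matched t))) (subst (e ∈L_) (unused-suc t) e∈)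
        in  e∈unused , λ ≡1 → ¬one (oneMatched⇐ (matched t) e ≡1)

      ∈unused-suc⁺ : ∀ t {e} → e ∈L unused t → ∣ e ∩ matched t ∣ ≢ 1 → e ∈L unused (suc t)
      ∈unused-suc⁺ t {e} e∈ ≢1 = subst (e ∈L_) (sym (unused-suc t))
                                   (∈-filter⁺ (∁? (oneMatched? (matched t))) e∈ λ one → ≢1 (oneMatched⇒ (matched t) e one))

      ∈new⁻ : ∀ t {b} → b ∈L new t → ∃ λ e → e ∈L unused t × ∣ e ∩ matched t ∣ ≡ 1 × b ≡ e ─ matched t
      ∈new⁻ t b∈ with ∈-map⁻ (λ e → e ─ matched t) b∈
      ... | e , e∈ , refl =
        let e∈unused , one = ∈-filter⁻ (oneMatched? (matched t))
                               (subst (e ∈L_) (partition-proj₁ (oneMatched? (matched t)) (unused t)) e∈)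
        in  e , e∈unused , oneMatched⇒ (matched t) e one , refl

      ∈new⁺ : ∀ t {e} → e ∈L unused t → ∣ e ∩ matched t ∣ ≡ 1 → (e ─ matched t) ∈L new t
      ∈new⁺ t {e} e∈ ≡1 = ∈-map⁺ (λ e → e ─ matched t)
                            (subst (e ∈L_) (sym (partition-proj₁ (oneMatched? (matched t)) (unused t)))
                              (∈-filter⁺ (oneMatched? (matched t)) e∈ (oneMatched⇐ (matched t) e ≡1)))


module TreeOfParents (r′ m : ℕ) (M : List (Subset m)) (pm : IsPerfectMatching (suc r′) m M) where
  open import Data.Nat as ℕ using (ℕ; zero; suc; _+_; _*_; _≤_; _<_; s≤s; z≤n)
  import Data.Nat.Properties as ℕP
  open import Data.Fin as F using (Fin; zero; suc; fromℕ; inject₁; cast)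
  import Data.Fin.Properties as FP
  open import Data.Fin.Subset
  open import Data.Fin.Subset.Properties
  open import Data.List as L using (List; []; _∷_; length; lookup; tabulate)
  import Data.List.Properties as LP
  open import Data.List.Membership.Propositional using () renaming (_∈_ to _∈L_)
  import Data.List.Membership.Propositional.Properties as LMP
  import Data.List.Relation.Unary.Any as Any
  import Data.List.Relation.Unary.Any.Properties as AnyP
  open import Data.List.Relation.Unary.All as All using (All)
  import Data.List.Relation.Unary.All.Properties as AllP
  import Data.List.Relation.Unary.Unique.Propositional.Properties as UP
  open import Relation.Binary.Construct.Closure.ReflexiveTransitive as Star using (Star; ε; _◅_; _◅◅_)
  open import Data.List.Relation.Unary.Unique.Propositional using (Unique)
  open import Data.Maybe using (Maybe; just; nothing)
  open import Data.Product
  open import Data.Sum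
  open import Data.Empty renaming (⊥ to ⊥e)
  open import Relation.Nullary
  open import Relation.Binary.PropositionalEquality
  open import Function using (_∘_; _$_)
  open import Defs
  open Subsets
  open Incidence using (isCycle⁻; Adj-sym)

  open Blocks (suc r′) m M pm public

  sp : Fin (suc m)
  sp = fromℕ m

  blockEdge : Fin K → Subset (suc m)
  blockEdge j = extend (lookup M j)

  module Hyperedges (parent : Fin K → Fin (suc m)) (d : Fin K → ℕ)
             (height-decreasing : ∀ j a → parent j ≡ inject₁ a → d (blockOf a) < d j) where

    hyperedge : Fin K → Subset (suc m)
    hyperedge j = blockEdge j ∪ ⁅ parent j ⁆

    hyperedges : List (Subset (suc m))
    hyperedges = tabulate hyperedge

    parent∉block : ∀ j → parent j ∉ extend (lookup M j)
    parent∉block j h with ∈extend-inject₁ h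
    ... | (a , e , aM) = ℕP.<-irrefl (cong d (sym (blockOf-unique aM))) (height-decreasing j a e)

    ∈hyperedge⁻ : ∀ {j x} → x ∈ hyperedge j → x ∈ extend (lookup M j) ⊎ x ≡ parent j
    ∈hyperedge⁻ {j} h = Data.Sum.map₂ ∈⁅⁆⇒≡ (x∈p∪q⁻ _ _ h)

    ∈hyperedge⁺ : ∀ {j x} → x ∈ extend (lookup M j) → x ∈ hyperedge j
    ∈hyperedge⁺ h = x∈p∪q⁺ (inj₁ h)

    parent∈hyperedge : ∀ j → parent j ∈ hyperedge j
    parent∈hyperedge j = x∈p∪q⁺ (inj₂ (x∈⁅x⁆ (parent j)))

    hyperedge-injective : ∀ {j j′} → hyperedge j ≡ hyperedge j′ → j ≡ j′
    hyperedge-injective {j} {j′} e with ∈hyperedge⁻ (subst (inject₁ (element j zero) ∈_) e (∈hyperedge⁺ (∈extend⁺ (element∈block j zero))))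
                         | ∈hyperedge⁻ (subst (inject₁ (element j′ zero) ∈_) (sym e) (∈hyperedge⁺ (∈extend⁺ (element∈block j′ zero))))
    ... | inj₁ h | _ = trans (sym (blockOf-element j zero)) (sym (blockOf-unique (∈extend⁻ h)))
    ... | inj₂ _ | inj₁ h = trans (blockOf-unique (∈extend⁻ h)) (blockOf-element j′ zero)
    ... | inj₂ e1 | inj₂ e2 = ⊥-elim (ℕP.<-asym (subst (_< d j′) (cong d (blockOf-element j zero)) (height-decreasing j′ _ (sym e1)))
                                                 (subst (_< d j) (cong d (blockOf-element j′ zero)) (height-decreasing j _ (sym e2))))

    hyperedges-unique : Unique hyperedges
    hyperedges-unique = UP.tabulate⁺ hyperedge-injective

    -- Heights on the incidence graph: a vertex lies just above the hyperedge of its own block and strictly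
    -- below the hyperedge it is the parent of.
    addressHeight : Maybe (Fin K × Fin (suc r′)) → ℕ
    addressHeight nothing        = 0
    addressHeight (just (j , _)) = 2 * d j + 2

    vertexHeight : Fin (suc m) → ℕ
    vertexHeight v = addressHeight (address v)

    edgeHeight : Fin K → ℕ
    edgeHeight j = 2 * d j + 1

    vertexHeight-special : vertexHeight sp ≡ 0
    vertexHeight-special = cong addressHeight address-fromℕ

    edgeHeight<vertexHeight : ∀ a → edgeHeight (blockOf a) < vertexHeight (inject₁ a)
    edgeHeight<vertexHeight a = subst (edgeHeight (blockOf a) <_) (sym (cong addressHeight (address-inject₁ a)))
                                  (ℕP.+-monoʳ-< (2 * d (blockOf a)) (s≤s (s≤s z≤n)))

    vertexHeight-parent< : ∀ j → vertexHeight (parent j) < edgeHeight j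
    vertexHeight-parent< j = below (fromℕ-or-inject₁ (parent j))
      where
      y<x⇒2y+2<2x+1 : ∀ {y x} → y < x → 2 * y + 2 < 2 * x + 1
      y<x⇒2y+2<2x+1 {y} {x} y<x = ℕP.≤-trans (ℕP.≤-reflexive eq) (ℕP.+-monoˡ-≤ 1 (ℕP.*-monoʳ-≤ 2 y<x))
        where
        eq : suc (2 * y + 2) ≡ 2 * suc y + 1
        eq = trans (ℕP.+-comm 1 (2 * y + 2)) (cong (_+ 1) (trans (ℕP.+-comm (2 * y) 2) (sym (ℕP.*-suc 2 y))))
      below : parent j ≡ sp ⊎ ∃ (λ a → parent j ≡ inject₁ a) → vertexHeight (parent j) < edgeHeight j
      below (inj₁ pv≡sp) = subst (_< edgeHeight j) (sym (trans (cong vertexHeight pv≡sp) vertexHeight-special))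
                             (ℕP.m≤n+m 1 (2 * d j))
      below (inj₂ (a , pv≡a)) = subst (_< edgeHeight j) (sym (trans (cong vertexHeight pv≡a) (cong addressHeight (address-inject₁ a))))
                                  (y<x⇒2y+2<2x+1 (height-decreasing j a pv≡a))

    hyperedges-size : All (λ e → ∣ e ∣ ≡ suc (suc r′)) hyperedges
    hyperedges-size = AllP.tabulate⁺ λ j → trans (∣p∪⁅x⁆∣≡1+∣p∣ _ (parent j) (parent∉block j))
                                               (cong suc (trans (∣extend∣ (lookup M j)) (∣block∣≡R j)))


    length-hyperedges : length hyperedges ≡ K
    length-hyperedges = LP.length-tabulate hyperedge

    toBlock : Fin (length hyperedges) → Fin K
    toBlock = cast length-hyperedges

    toIndex : Fin K → Fin (length hyperedges)
    toIndex = cast (sym length-hyperedges)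

    lookup-hyperedges-toIndex : ∀ j → lookup hyperedges (toIndex j) ≡ hyperedge j
    lookup-hyperedges-toIndex = LP.lookup-tabulate hyperedge

    toBlock-toIndex : ∀ j → toBlock (toIndex j) ≡ j
    toBlock-toIndex j = FP.cast-involutive length-hyperedges (sym length-hyperedges) j

    toIndex-toBlock : ∀ i → toIndex (toBlock i) ≡ i
    toIndex-toBlock i = FP.cast-involutive (sym length-hyperedges) length-hyperedges i

    lookup-hyperedges : ∀ i → lookup hyperedges i ≡ hyperedge (toBlock i)
    lookup-hyperedges i = trans (cong (lookup hyperedges) (sym (toIndex-toBlock i))) (lookup-hyperedges-toIndex (toBlock i))

  module SpanningTree (parent : Fin K → Fin (suc m)) (level : Fin K → ℕ)
              (level≤K : ∀ j → level j ≤ K)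
              (level-special : ∀ j → parent j ≡ fromℕ m → level j ≡ 0)
              (level-child : ∀ j a → parent j ≡ inject₁ a → level j ≡ suc (level (blockOf a))) where

    height-decreasing : ∀ j a → parent j ≡ inject₁ a → level (blockOf a) < level j
    height-decreasing j a e = ℕP.≤-reflexive (sym (level-child j a e))

    open Hyperedges parent level height-decreasing public


    Nd = Node (suc m) hyperedges
    A = Adj hyperedges

    hyperedge-adj-parent : ∀ j {v} → parent j ≡ v → A (inj₂ (toIndex j)) (inj₁ v)
    hyperedge-adj-parent j refl = subst (parent j ∈_) (sym (lookup-hyperedges-toIndex j)) (parent∈hyperedge j)

    vertex-adj-hyperedge : ∀ a → A (inj₁ (inject₁ a)) (inj₂ (toIndex (blockOf a)))
    vertex-adj-hyperedge a = subst (inject₁ a ∈_) (sym (lookup-hyperedges-toIndex (blockOf a))) (∈hyperedge⁺ (∈extend⁺ (∈blockOf a)))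

    -- Adj is a computed relation, so the middle node of each step is given explicitly.
    via : ∀ {x z} y → A x y → Star A y z → Star A x z
    via y x—y y⇝z = x—y ◅ y⇝z

    hyperedge⇝special : ∀ f j → level j < f → Star A (inj₂ (toIndex j)) (inj₁ sp)
    hyperedge⇝special (suc f) j lt with fromℕ-or-inject₁ (parent j)
    ... | inj₁ e = via (inj₁ sp) (hyperedge-adj-parent j e) ε
    ... | inj₂ (a , e) = via (inj₁ (inject₁ a)) (hyperedge-adj-parent j e) $
                         via (inj₂ (toIndex (blockOf a))) (vertex-adj-hyperedge a) $
                         hyperedge⇝special f (blockOf a) (ℕP.<-≤-trans (height-decreasing j a e) (ℕ.s≤s⁻¹ lt))

    ⇝special : ∀ x → Star A x (inj₁ sp)
    ⇝special (inj₁ v) with fromℕ-or-inject₁ v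
    ... | inj₁ refl = ε
    ... | inj₂ (a , refl) = via (inj₂ (toIndex (blockOf a))) (vertex-adj-hyperedge a) $
                            hyperedge⇝special (suc K) (blockOf a) (s≤s (level≤K (blockOf a)))
    ⇝special (inj₂ i) = subst (λ z → Star A (inj₂ z) (inj₁ sp)) (toIndex-toBlock i)
                          (hyperedge⇝special (suc K) (toBlock i) (s≤s (level≤K (toBlock i))))

    hyperedges-connected : Connected hyperedges
    hyperedges-connected x y = ⇝special x ◅◅ Star.reverse Adj-sym (⇝special y)


    Down : Nd → Nd → Set
    Down (inj₁ v) (inj₂ i) = Σ (Fin m) λ a → v ≡ inject₁ a × i ≡ toIndex (blockOf a)
    Down (inj₂ i) (inj₁ v) = v ≡ parent (toBlock i)
    Down _ _ = ⊥e

    height : Nd → ℕ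
    height (inj₁ v) = vertexHeight v
    height (inj₂ i) = edgeHeight (toBlock i)

    adj⇒down : ∀ {x y} → A x y → Down x y ⊎ Down y x
    adj⇒down {inj₁ v} {inj₂ i} h with ∈hyperedge⁻ (subst (v ∈_) (lookup-hyperedges i) h)
    ... | inj₂ e = inj₂ e
    ... | inj₁ h′ with ∈extend-inject₁ h′
    ...   | (a , refl , aM) = inj₁ (a , refl , trans (sym (toIndex-toBlock i)) (cong toIndex (blockOf-unique aM)))
    adj⇒down {inj₂ i} {inj₁ v} h with ∈hyperedge⁻ (subst (v ∈_) (lookup-hyperedges i) h)
    ... | inj₂ e = inj₁ e
    ... | inj₁ h′ with ∈extend-inject₁ h′
    ...   | (a , refl , aM) = inj₂ (a , refl , trans (sym (toIndex-toBlock i)) (cong toIndex (blockOf-unique aM)))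

    down-functional : ∀ {x y z} → Down x y → Down x z → y ≡ z
    down-functional {inj₁ v} {inj₂ i} {inj₂ i′} (a , e , q) (a′ , e′ , q′) with FP.inject₁-injective (trans (sym e) e′)
    ... | refl = cong inj₂ (trans q (sym q′))
    down-functional {inj₂ i} {inj₁ v} {inj₁ v′} e e′ = cong inj₁ (trans e (sym e′))

    down-decreasing : ∀ {x y} → Down x y → height y < height x
    down-decreasing {inj₁ v} {inj₂ i} (a , refl , refl) = subst (λ j → edgeHeight j < vertexHeight (inject₁ a))
                                                            (sym (toBlock-toIndex (blockOf a)))
                                                (edgeHeight<vertexHeight a)
    down-decreasing {inj₂ i} {inj₁ v} refl = vertexHeight-parent< (toBlock i)

    open Walks A
    open NoCycle Down height adj⇒down down-functional down-decreasing

    hyperedges-acyclic : Acyclic hyperedges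
    hyperedges-acyclic [] ()
    hyperedges-acyclic (x ∷ []) ()
    hyperedges-acyclic (x ∷ y ∷ []) ()
    hyperedges-acyclic (x0 ∷ x1 ∷ x2 ∷ xs) c = no-cycle x0 x1 x2 xs (proj₁ c) (proj₁ (proj₂ c)) (isCycle⁻ x2 xs c)


    open MatchingRounds
    open import Data.Vec using (init)
    open Run {m} hyperedges hiding (sp)

    blockEdge-disjoint : ∀ {x j j′} → x ∈ blockEdge j → x ∈ blockEdge j′ → j ≡ j′
    blockEdge-disjoint h h′ with ∈extend-inject₁ h | ∈extend-inject₁ h′
    ... | (a , refl , aM) | (a′ , e , aM′) with FP.inject₁-injective e
    ... | refl = trans (blockOf-unique aM) (sym (blockOf-unique aM′))

    special∈hyperedge⇒ : ∀ j → sp ∈ hyperedge j → parent j ≡ sp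
    special∈hyperedge⇒ j h with ∈hyperedge⁻ h
    ... | inj₁ h′ = ⊥-elim (fromℕ∉extend _ h′)
    ... | inj₂ e = sym e

    level≡0⇒ : ∀ j → level j ≡ 0 → parent j ≡ sp
    level≡0⇒ j e0 with fromℕ-or-inject₁ (parent j)
    ... | inj₁ e = e
    ... | inj₂ (a , e) with () ← trans (sym e0) (level-child j a e)

    ∈hyperedges⁻ : ∀ {e} → e ∈L hyperedges → ∃ λ j → e ≡ hyperedge j
    ∈hyperedges⁻ h = LMP.∈-tabulate⁻ h

    ∈hyperedges⁺ : ∀ j → hyperedge j ∈L hyperedges
    ∈hyperedges⁺ j = LMP.∈-tabulate⁺ j

    hyperedge-special : ∀ j → parent j ≡ sp → hyperedge j - sp ≡ blockEdge j
    hyperedge-special j e = subset-ext to from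
      where
      to : ∀ x → x ∈ hyperedge j - sp → x ∈ blockEdge j
      to x h with x∈p-y⁻ (hyperedge j) sp h
      ... | (xh , x≢) with ∈hyperedge⁻ xh
      ...   | inj₁ q = q
      ...   | inj₂ q = ⊥-elim (x≢ (trans q e))
      from : ∀ x → x ∈ blockEdge j → x ∈ hyperedge j - sp
      from x h = x∈p∧x≢y⇒x∈p-y (∈hyperedge⁺ h) (λ q → fromℕ∉extend _ (subst (_∈ blockEdge j) q h))

    record RoundInvariant (t : ℕ) : Set where
      field
        matched⇒ : ∀ x → x ∈ matched t → ∃ λ j → level j ≤ t × x ∈ blockEdge j
        matched⇐ : ∀ x j → level j ≤ t → x ∈ blockEdge j → x ∈ matched t
        unused⇒ : ∀ e → e ∈L unused t → ∃ λ j → t < level j × e ≡ hyperedge j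
        unused⇐ : ∀ j → t < level j → hyperedge j ∈L unused t
        found⇒ : ∀ b → b ∈L found t → ∃ λ j → level j ≤ t × b ≡ blockEdge j
        found⇐ : ∀ j → level j ≤ t → blockEdge j ∈L found t

    invariant₀ : RoundInvariant 0
    invariant₀ = record { matched⇒ = matched⇒ ; matched⇐ = matched⇐ ; unused⇒ = unused⇒ ; unused⇐ = unused⇐
                        ; found⇒ = found⇒ ; found⇐ = found⇐ }
      where
      found⇒ : ∀ b → b ∈L found 0 → ∃ λ j → level j ≤ 0 × b ≡ blockEdge j
      found⇒ b h with ∈found₀⁻ h
      ... | (e , eG , spe , refl) with ∈hyperedges⁻ eG
      ... | (j , refl) = j , ℕP.≤-reflexive (level-special j (special∈hyperedge⇒ j spe)) , hyperedge-special j (special∈hyperedge⇒ j spe)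
      found⇐ : ∀ j → level j ≤ 0 → blockEdge j ∈L found 0
      found⇐ j le = subst (_∈L found 0) (hyperedge-special j pvsp)
                      (∈found₀⁺ (∈hyperedges⁺ j) (subst (_∈ hyperedge j) pvsp (parent∈hyperedge j)))
        where
        pvsp = level≡0⇒ j (ℕP.n≤0⇒n≡0 le)
      matched⇒ : ∀ x → x ∈ matched 0 → ∃ λ j → level j ≤ 0 × x ∈ blockEdge j
      matched⇒ x h with x∈⋃⁻ (found 0) h
      ... | (b , bB , xb) with found⇒ b bB
      ... | (j , le , refl) = j , le , xb
      matched⇐ : ∀ x j → level j ≤ 0 → x ∈ blockEdge j → x ∈ matched 0
      matched⇐ x j le h = x∈⋃⁺ (found 0) (found⇐ j le) h
      unused⇒ : ∀ e → e ∈L unused 0 → ∃ λ j → 0 < level j × e ≡ hyperedge j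
      unused⇒ e h with ∈unused₀⁻ h
      ... | (eG , nsp) with ∈hyperedges⁻ eG
      ... | (j , refl) with level j in eq
      ...   | suc _ = j , subst (0 <_) (sym eq) (s≤s z≤n) , refl
      ...   | zero = ⊥-elim (nsp (subst (_∈ hyperedge j) (level≡0⇒ j eq) (parent∈hyperedge j)))
      unused⇐ : ∀ j → 0 < level j → hyperedge j ∈L unused 0
      unused⇐ j lt = ∈unused₀⁺ (∈hyperedges⁺ j) λ s → ℕP.<-irrefl (sym (level-special j (special∈hyperedge⇒ j s))) lt

    module Step (t : ℕ) (I : RoundInvariant t) where
      open RoundInvariant I

      hyperedge∩matched⇒ : ∀ j → t < level j → ∀ x → x ∈ hyperedge j → x ∈ matched t → x ≡ parent j × level j ≡ suc t
      hyperedge∩matched⇒ j lt x xh xS with matched⇒ x xS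
      ... | (j′ , le , xj′) with ∈hyperedge⁻ xh
      ...   | inj₁ xj = ⊥-elim (ℕP.<-irrefl refl (ℕP.<-≤-trans lt (subst (λ z → level z ≤ t) (sym (blockEdge-disjoint xj xj′)) le)))
      ...   | inj₂ refl with ∈extend-inject₁ xj′
      ...     | (a , e , aM) = refl , ℕP.≤-antisym (subst (_≤ suc t) (sym level≡) (s≤s le)) lt
        where level≡ = trans (level-child j a e) (cong (suc ∘ level) (sym (blockOf-unique aM)))

      parent∈matched : ∀ j → level j ≡ suc t → parent j ∈ matched t
      parent∈matched j e with fromℕ-or-inject₁ (parent j)
      ... | inj₁ q with () ← trans (sym (level-special j q)) e
      ... | inj₂ (a , q) = subst (_∈ matched t) (sym q)
                             (matched⇐ (inject₁ a) (blockOf a) (ℕP.≤-reflexive (ℕP.suc-injective (trans (sym (level-child j a q)) e)))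
                                       (∈extend⁺ (∈blockOf a)))

      hyperedge∩matched≡parent : ∀ j → level j ≡ suc t → hyperedge j ∩ matched t ≡ ⁅ parent j ⁆
      hyperedge∩matched≡parent j e = subset-ext
        (λ x x∈ → let x∈h , x∈m = x∈p∩q⁻ _ _ x∈
                  in  subst (_∈ ⁅ parent j ⁆) (sym (proj₁ (hyperedge∩matched⇒ j lt x x∈h x∈m))) (x∈⁅x⁆ (parent j)))
        (λ x x∈ → subst (_∈ hyperedge j ∩ matched t) (sym (∈⁅⁆⇒≡ x∈)) (x∈p∩q⁺ (parent∈hyperedge j , parent∈matched j e)))
        where
        lt : t < level j
        lt = subst (t <_) (sym e) ℕP.≤-refl

      hyperedge∩matched≡∅ : ∀ j → suc t < level j → hyperedge j ∩ matched t ≡ ⊥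
      hyperedge∩matched≡∅ j lt = subset-ext
        (λ x x∈ → let x∈h , x∈m = x∈p∩q⁻ _ _ x∈
                  in  ⊥-elim (ℕP.<-irrefl (sym (proj₂ (hyperedge∩matched⇒ j (ℕP.<-trans ℕP.≤-refl lt) x x∈h x∈m))) lt))
                          (λ x h → ⊥-elim (∉⊥ h))

      hyperedge─matched : ∀ j → level j ≡ suc t → hyperedge j ─ matched t ≡ blockEdge j
      hyperedge─matched j e = subset-ext to from
        where
        lt : t < level j
        lt = subst (t <_) (sym e) ℕP.≤-refl
        to : ∀ x → x ∈ hyperedge j ─ matched t → x ∈ blockEdge j
        to x h with x∈p─q⁻ (hyperedge j) (matched t) h
        ... | (xh , xS) with ∈hyperedge⁻ xh
        ...   | inj₁ q = q
        ...   | inj₂ refl = ⊥-elim (xS (parent∈matched j e))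
        from : ∀ x → x ∈ blockEdge j → x ∈ hyperedge j ─ matched t
        from x h = x∈p∧x∉q⇒x∈p─q (∈hyperedge⁺ h) (contra x h)
          where
          contra : ∀ x → x ∈ blockEdge j → x ∉ matched t
          contra x h xS with matched⇒ x xS
          ... | (j′ , le , xj′) = ℕP.<-irrefl refl (ℕP.<-≤-trans lt (subst (λ z → level z ≤ t) (sym (blockEdge-disjoint h xj′)) le))

      ∣hyperedge∩matched∣≡1 : ∀ j → level j ≡ suc t → ∣ hyperedge j ∩ matched t ∣ ≡ 1
      ∣hyperedge∩matched∣≡1 j e = trans (cong ∣_∣ (hyperedge∩matched≡parent j e)) (∣⁅x⁆∣≡1 (parent j))

      ∣hyperedge∩matched∣≢1 : ∀ j → suc t < level j → ∣ hyperedge j ∩ matched t ∣ ≢ 1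
      ∣hyperedge∩matched∣≢1 j lt q with () ← trans (sym q) (trans (cong ∣_∣ (hyperedge∩matched≡∅ j lt)) (∣⊥∣≡0 (suc m)))

      new⇒ : ∀ b → b ∈L new t → ∃ λ j → level j ≡ suc t × b ≡ blockEdge j
      new⇒ b h with ∈new⁻ t h
      ... | (e , eR , c1 , refl) with unused⇒ e eR
      ... | (j , lt , refl) with level j ℕ.≟ suc t
      ...   | yes q = j , q , hyperedge─matched j q
      ...   | no nq = ⊥-elim (∣hyperedge∩matched∣≢1 j (ℕP.≤∧≢⇒< lt (λ z → nq (sym z))) c1)

      new⇐ : ∀ j → level j ≡ suc t → blockEdge j ∈L new t
      new⇐ j e = subst (_∈L new t) (hyperedge─matched j e)
                   (∈new⁺ t (unused⇐ j (subst (t <_) (sym e) ℕP.≤-refl)) (∣hyperedge∩matched∣≡1 j e))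

      invariant-suc : RoundInvariant (suc t)
      invariant-suc = record { matched⇒ = matched⇒′ ; matched⇐ = matched⇐′ ; unused⇒ = unused⇒′ ; unused⇐ = unused⇐′
                             ; found⇒ = found⇒′ ; found⇐ = found⇐′ }
        where
        matched⇒′ : ∀ x → x ∈ matched (suc t) → ∃ λ j → level j ≤ suc t × x ∈ blockEdge j
        matched⇒′ x h with x∈p∪q⁻ (matched t) (⋃ (new t)) (subst (x ∈_) (matched-suc t) h)
        ... | inj₁ a = let (j , le , xj) = matched⇒ x a in j , ℕP.m≤n⇒m≤1+n le , xj
        ... | inj₂ a with x∈⋃⁻ (new t) a
        ...   | (b , bn , xb) with new⇒ b bn
        ...     | (j , e , refl) = j , ℕP.≤-reflexive e , xb
        matched⇐′ : ∀ x j → level j ≤ suc t → x ∈ blockEdge j → x ∈ matched (suc t)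
        matched⇐′ x j le h with level j ℕ.≟ suc t
        ... | yes e = subst (x ∈_) (sym (matched-suc t)) (x∈p∪q⁺ (inj₂ (x∈⋃⁺ (new t) (new⇐ j e) h)))
        ... | no ne = subst (x ∈_) (sym (matched-suc t)) (x∈p∪q⁺ (inj₁ (matched⇐ x j (ℕ.s≤s⁻¹ (ℕP.≤∧≢⇒< le ne)) h)))
        unused⇒′ : ∀ e → e ∈L unused (suc t) → ∃ λ j → suc t < level j × e ≡ hyperedge j
        unused⇒′ e h with ∈unused-suc⁻ t h
        ... | (eR , n1) with unused⇒ e eR
        ... | (j , lt , refl) with level j ℕ.≟ suc t
        ...   | yes q = ⊥-elim (n1 (∣hyperedge∩matched∣≡1 j q))
        ...   | no nq = j , ℕP.≤∧≢⇒< lt (λ z → nq (sym z)) , refl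
        unused⇐′ : ∀ j → suc t < level j → hyperedge j ∈L unused (suc t)
        unused⇐′ j lt = ∈unused-suc⁺ t (unused⇐ j (ℕP.<-trans ℕP.≤-refl lt)) (∣hyperedge∩matched∣≢1 j lt)
        found⇒′ : ∀ b → b ∈L found (suc t) → ∃ λ j → level j ≤ suc t × b ≡ blockEdge j
        found⇒′ b h with LMP.∈-++⁻ (found t) (subst (b ∈L_) (found-suc t) h)
        ... | inj₁ a = let (j , le , q) = found⇒ b a in j , ℕP.m≤n⇒m≤1+n le , q
        ... | inj₂ a = let (j , e , q) = new⇒ b a in j , ℕP.≤-reflexive e , q
        found⇐′ : ∀ j → level j ≤ suc t → blockEdge j ∈L found (suc t)
        found⇐′ j le with level j ℕ.≟ suc t
        ... | yes e = subst (blockEdge j ∈L_) (sym (found-suc t)) (LMP.∈-++⁺ʳ (found t) (new⇐ j e))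
        ... | no ne = subst (blockEdge j ∈L_) (sym (found-suc t)) (LMP.∈-++⁺ˡ (found⇐ j (ℕ.s≤s⁻¹ (ℕP.≤∧≢⇒< le ne))))

    invariant : ∀ t → RoundInvariant t
    invariant zero = invariant₀
    invariant (suc t) = Step.invariant-suc t (invariant t)

    μ-hyperedges : μ hyperedges ≋ M
    μ-hyperedges b = to , from
      where
      L = length hyperedges
      I = invariant L
      open RoundInvariant I
      to : b ∈L μ hyperedges → b ∈L M
      to h with LMP.∈-map⁻ init h
      ... | (b′ , b′B , refl) with found⇒ b′ b′B
      ... | (j , _ , refl) = subst (_∈L M) (sym (init-extend (lookup M j))) (LMP.∈-lookup j)
      from : b ∈L M → b ∈L μ hyperedges
      from h = subst (_∈L μ hyperedges) (trans (init-extend (lookup M j)) (sym (AnyP.lookup-index h)))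
                 (LMP.∈-map⁺ init (found⇐ j (subst (level j ≤_) (sym length-hyperedges) (level≤K j))))
        where
        j = Any.index h

    hyperedges-spanningTree : IsSpanningTree (suc (suc r′)) (suc m) hyperedges
    hyperedges-spanningTree = hyperedges-unique , hyperedges-size , hyperedges-connected , hyperedges-acyclic


module ParentsOfTree (r′ m : ℕ) (M : List (Subset m)) (pm : IsPerfectMatching (suc r′) m M) where

  open import Data.Nat as ℕ using (zero; _+_; _≤_; _<_; s≤s; z≤n)
  import Data.Nat.Properties as ℕP
  open import Data.Fin as F using (Fin; zero; suc; inject₁)
  import Data.Fin.Properties as FP
  import Data.Bool as Bool
  open import Data.Fin.Subset
  open import Data.Fin.Subset.Properties
  open import Data.Vec using (init)
  import Data.Vec.Properties as VP
  open import Data.List as L using ([]; _∷_; lookup; length; map)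
  open import Data.List.Membership.Propositional using () renaming (_∈_ to _∈L_)
  import Data.List.Membership.Propositional.Properties as LMP
  import Data.List.Membership.DecPropositional as LMD
  import Data.List.Relation.Unary.Any as Any
  import Data.List.Relation.Unary.Any.Properties as AnyP
  open import Data.List.Relation.Unary.All as All using (All)
  open import Data.List.Relation.Unary.Unique.Propositional using (Unique)
  import Data.List.Relation.Unary.AllPairs as AllPairs
  import Data.List.Relation.Unary.Linked as Linked
  open import Data.List.Relation.Binary.Permutation.Propositional using (_↭_)
  open import Data.List.Relation.Binary.Permutation.Propositional.Properties using (↭-length)
  open import Data.Product
  open import Data.Sum
  open import Data.Sum.Properties using (inj₂-injective; ≡-dec)
  open import Data.Unit using (tt)
  open import Data.Empty renaming (⊥ to ⊥e)
  open import Relation.Nullary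
  open import Relation.Binary.PropositionalEquality
  open Subsets
  open LeastSearch
  open MatchingRounds
  open UniqueLists
  open TreeOfParents r′ m M pm

  restore-special : ∀ (e : Subset (suc m)) → sp ∈ e → (e - sp) ∪ ⁅ sp ⁆ ≡ e
  restore-special e spe = subset-ext to from
    where
    to : ∀ x → x ∈ (e - sp) ∪ ⁅ sp ⁆ → x ∈ e
    to x h with x∈p∪q⁻ _ _ h
    ... | inj₁ a = proj₁ (x∈p-y⁻ e sp a)
    ... | inj₂ a = subst (_∈ e) (sym (∈⁅⁆⇒≡ a)) spe
    from : ∀ x → x ∈ e → x ∈ (e - sp) ∪ ⁅ sp ⁆
    from x h with x FP.≟ sp
    ... | yes refl = x∈p∪q⁺ (inj₂ (x∈⁅x⁆ sp))
    ... | no ne = x∈p∪q⁺ (inj₁ (x∈p∧x≢y⇒x∈p-y h ne))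

  restore-matched : ∀ (e matched : Subset (suc m)) v → e ∩ matched ≡ ⁅ v ⁆ → (e ─ matched) ∪ ⁅ v ⁆ ≡ e
  restore-matched e matched v eq = subset-ext to from
    where
    vin : v ∈ e ∩ matched
    vin = subst (v ∈_) (sym eq) (x∈⁅x⁆ v)
    to : ∀ x → x ∈ (e ─ matched) ∪ ⁅ v ⁆ → x ∈ e
    to x h with x∈p∪q⁻ _ _ h
    ... | inj₁ a = proj₁ (x∈p─q⁻ e matched a)
    ... | inj₂ a = subst (_∈ e) (sym (∈⁅⁆⇒≡ a)) (proj₁ (x∈p∩q⁻ e matched vin))
    from : ∀ x → x ∈ e → x ∈ (e ─ matched) ∪ ⁅ v ⁆
    from x h with x ∈? matched
    ... | yes xS = x∈p∪q⁺ (inj₂ (subst (x ∈_) eq (x∈p∩q⁺ (h , xS))))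
    ... | no nS = x∈p∪q⁺ (inj₁ (x∈p∧x∉q⇒x∈p─q h nS))

  _≟ₛ_ : (a b : Subset (suc m)) → Dec (a ≡ b)
  _≟ₛ_ = VP.≡-dec Bool._≟_

  module FromTree (T : List (Subset (suc m))) (tr : IsSpanningTree (suc (suc r′)) (suc m) T) (mu : μ T ≋ M) where
    open Run {m} T hiding (sp)

    L = length T

    unused⊆ : ∀ t {e} → e ∈L unused t → e ∈L T × sp ∉ e
    unused⊆ zero h = ∈unused₀⁻ h
    unused⊆ (suc t) h = unused⊆ t (proj₁ (∈unused-suc⁻ t h))

    special∉found : ∀ t {b} → b ∈L found t → sp ∉ b
    special∉found zero h with ∈found₀⁻ h
    ... | (e , _ , _ , refl) = λ s → proj₂ (x∈p-y⁻ e sp s) refl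
    special∉found (suc t) {b} h with LMP.∈-++⁻ (found t) (subst (b ∈L_) (found-suc t) h)
    ... | inj₁ a = special∉found t a
    ... | inj₂ a with ∈new⁻ t a
    ...   | (e , eR , _ , refl) = λ s → proj₂ (unused⊆ t eR) (p─q⊆p e (matched t) s)

    found-step : ∀ t {b} → b ∈L found t → b ∈L found (suc t)
    found-step t {b} h = subst (b ∈L_) (sym (found-suc t)) (LMP.∈-++⁺ˡ h)

    found-mono : ∀ d t {b} → b ∈L found t → b ∈L found (d + t)
    found-mono zero t h = h
    found-mono (suc d) t h = found-step (d + t) (found-mono d t h)

    found-final : ∀ t {b} → t ≤ L → b ∈L found t → b ∈L found L
    found-final t {b} le h with ℕP.m≤n⇒∃[o]m+o≡n le
    ... | (o , e) = subst (λ z → b ∈L found z) (trans (ℕP.+-comm o t) e) (found-mono o t h)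

    matched⇒found : ∀ t {x} → x ∈ matched t → ∃ λ b → b ∈L found t × x ∈ b
    matched⇒found zero h = x∈⋃⁻ (found 0) h
    matched⇒found (suc t) {x} h with x∈p∪q⁻ (matched t) (⋃ (new t)) (subst (x ∈_) (matched-suc t) h)
    ... | inj₁ a = let (b , bB , xb) = matched⇒found t a in b , found-step t bB , xb
    ... | inj₂ a = let (b , bn , xb) = x∈⋃⁻ (new t) a in b , subst (b ∈L_) (sym (found-suc t)) (LMP.∈-++⁺ʳ (found t) bn) , xb

    foundBlock : ∀ t {b} → t ≤ L → b ∈L found t → Σ (Fin K) λ j → b ≡ blockEdge j
    foundBlock t {b} le h = j , trans (fromℕ∉⇒≡extend b (special∉found t h)) (cong extend (AnyP.lookup-index inM))
      where
      inM : init b ∈L M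
      inM = proj₁ (mu (init b)) (LMP.∈-map⁺ init (found-final t le h))
      j = Any.index inM

    blockEdge∈found? : ∀ j t → Dec (blockEdge j ∈L found t)
    blockEdge∈found? j t = LMD._∈?_ _≟ₛ_ (blockEdge j) (found t)

    blockEdge∈final : ∀ j → blockEdge j ∈L found L
    blockEdge∈final j with LMP.∈-map⁻ init (proj₂ (mu (lookup M j)) (LMP.∈-lookup j))
    ... | (b , bB , e) = subst (_∈L found L) (trans (fromℕ∉⇒≡extend b (special∉found L bB)) (cong extend (sym e))) bB

    roundOf : Fin K → ℕ
    roundOf j = least (blockEdge∈found? j) L

    blockEdge∈found-roundOf : ∀ j → blockEdge j ∈L found (roundOf j)
    blockEdge∈found-roundOf j = least-satisfies (blockEdge∈found? j) L L ℕP.≤-refl (blockEdge∈final j)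

    roundOf≤L : ∀ j → roundOf j ≤ L
    roundOf≤L j = least≤bound (blockEdge∈found? j) L

    matched-earlier : ∀ j t v → t < roundOf j → t ≤ L → v ∈ matched t →
                      ∃ λ a → v ≡ inject₁ a × roundOf (blockOf a) < roundOf j
    matched-earlier j t v t<r t≤L v∈ =
      let b , b∈ , v∈b = matched⇒found t v∈
          _ , b≡ = foundBlock t t≤L b∈
          a , v≡ , a∈ = ∈extend-inject₁ (subst (v ∈_) b≡ v∈b)
          found-a = subst (λ i → blockEdge i ∈L found t) (blockOf-unique a∈) (subst (_∈L found t) b≡ b∈)
      in  a , v≡ , ℕP.≤-<-trans (least-≤ (blockEdge∈found? (blockOf a)) L t found-a) t<r

    HangsOn : Fin K → Set
    HangsOn j = Σ (Fin (suc m)) λ v → (blockEdge j ∪ ⁅ v ⁆) ∈L T × v ∉ blockEdge j ×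
                                      (v ≡ sp ⊎ ∃ λ a → v ≡ inject₁ a × roundOf (blockOf a) < roundOf j)

    -- Block j is found in round t + 1 from a hyperedge e of T meeting the matched vertices in one vertex v;
    -- then e = blockEdge j ∪ ⁅ v ⁆, and v lies in a block found earlier.
    hangsOn : ∀ j t → roundOf j ≡ t → HangsOn j
    hangsOn j zero eq with ∈found₀⁻ (subst (λ z → blockEdge j ∈L found z) eq (blockEdge∈found-roundOf j))
    ... | (e , eT , spe , q) =
      sp , subst (_∈L T) (sym (trans (cong (_∪ ⁅ sp ⁆) q) (restore-special e spe))) eT , fromℕ∉extend _ , inj₁ refl
    hangsOn j (suc t) eq = v ,
                        subst (_∈L T) (sym (trans (cong (_∪ ⁅ v ⁆) q) (restore-matched e (matched t) v ceq))) (proj₁ (unused⊆ t eR)) ,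
                        (λ vE → proj₂ (x∈p─q⁻ e (matched t) (subst (v ∈_) q vE)) vS) , inj₂ par
      where
      notB : ¬ (blockEdge j ∈L found t)
      notB = least-minimal (blockEdge∈found? j) L t (subst (t <_) (sym eq) ℕP.≤-refl)
      inNew : blockEdge j ∈L new t
      inNew with LMP.∈-++⁻ (found t) (subst (blockEdge j ∈L_) (found-suc t)
                                          (subst (λ z → blockEdge j ∈L found z) eq (blockEdge∈found-roundOf j)))
      ... | inj₁ a = ⊥-elim (notB a)
      ... | inj₂ a = a
      nw = ∈new⁻ t inNew
      e = proj₁ nw
      eR = proj₁ (proj₂ nw)
      c1 = proj₁ (proj₂ (proj₂ nw))
      q : blockEdge j ≡ e ─ matched t
      q = proj₂ (proj₂ (proj₂ nw))
      sg = ∣p∣≡1⇒singleton (e ∩ matched t) c1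
      v = proj₁ sg
      ceq : e ∩ matched t ≡ ⁅ v ⁆
      ceq = proj₂ sg
      vS : v ∈ matched t
      vS = proj₂ (x∈p∩q⁻ e (matched t) (subst (v ∈_) (sym ceq) (x∈⁅x⁆ v)))
      t≤L : t ≤ L
      t≤L = ℕP.≤-trans (ℕP.n≤1+n t) (subst (_≤ L) eq (roundOf≤L j))
      par : ∃ λ a → v ≡ inject₁ a × roundOf (blockOf a) < roundOf j
      par = matched-earlier j t v (subst (t <_) (sym eq) ℕP.≤-refl) t≤L vS

    hangs : ∀ j → HangsOn j
    hangs j = hangsOn j (roundOf j) refl

    parent : Fin K → Fin (suc m)
    parent j = proj₁ (hangs j)

    height-decreasing : ∀ j a → parent j ≡ inject₁ a → roundOf (blockOf a) < roundOf j
    height-decreasing j a e with proj₂ (proj₂ (proj₂ (hangs j)))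
    ... | inj₁ q = ⊥-elim (inject₁≢fromℕ a (trans (sym e) q))
    ... | inj₂ (a′ , q , lt) with FP.inject₁-injective (trans (sym q) e)
    ... | refl = lt

    open Hyperedges parent roundOf height-decreasing

    hyperedge∈T : ∀ j → hyperedge j ∈L T
    hyperedge∈T j = proj₁ (proj₂ (hangs j))

    indexInT : Fin K → Fin (length T)
    indexInT j = Any.index (hyperedge∈T j)

    lookup-indexInT : ∀ j → lookup T (indexInT j) ≡ hyperedge j
    lookup-indexInT j = sym (AnyP.lookup-index (hyperedge∈T j))

    Nd = Node (suc m) T
    A = Adj T

    open Walks A
    open Incidence using (isCycle⁺; Adj-sym)

    edgeHeightInT : ∀ {i} → Dec (∃ λ j → indexInT j ≡ i) → ℕ
    edgeHeightInT (yes (j , _)) = edgeHeight j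
    edgeHeightInT (no _) = 0

    height : Nd → ℕ
    height (inj₁ v) = vertexHeight v
    height (inj₂ i) = edgeHeightInT (FP.any? (λ j → indexInT j FP.≟ i))

    indexInT-injective : ∀ {j j′} → indexInT j ≡ indexInT j′ → j ≡ j′
    indexInT-injective {j} {j′} e = hyperedge-injective (trans (sym (lookup-indexInT j)) (trans (cong (lookup T) e) (lookup-indexInT j′)))

    height-indexInT : ∀ j → height (inj₂ (indexInT j)) ≡ edgeHeight j
    height-indexInT j with FP.any? (λ j′ → indexInT j′ FP.≟ indexInT j)
    ... | yes (j′ , e) = cong edgeHeight (indexInT-injective e)
    ... | no ne = ⊥-elim (ne (j , refl))

    In : Nd → Set
    In (inj₁ _) = Data.Unit.⊤
    In (inj₂ i) = ∃ λ j → indexInT j ≡ i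

    root : Nd
    root = inj₁ sp

    downV : ∀ v → inj₁ v ≢ root → (v ≡ sp ⊎ ∃ λ a → v ≡ inject₁ a) → Nd
    downV v ne (inj₁ e) = ⊥-elim (ne (cong inj₁ e))
    downV v ne (inj₂ (a , _)) = inj₂ (indexInT (blockOf a))

    down : ∀ x → In x → x ≢ root → Nd
    down (inj₁ v) _ ne = downV v ne (fromℕ-or-inject₁ v)
    down (inj₂ i) (j , _) _ = inj₁ (parent j)

    down-In : ∀ x p q → In (down x p q)
    down-In (inj₁ v) _ ne = h (fromℕ-or-inject₁ v)
      where
      h : ∀ s → In (downV v ne s)
      h (inj₁ e) = ⊥-elim (ne (cong inj₁ e))
      h (inj₂ (a , _)) = blockOf a , refl
    down-In (inj₂ i) (j , _) _ = tt

    down-adj : ∀ x p q → A x (down x p q)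
    down-adj (inj₁ v) _ ne = h (fromℕ-or-inject₁ v)
      where
      h : ∀ s → A (inj₁ v) (downV v ne s)
      h (inj₁ e) = ⊥-elim (ne (cong inj₁ e))
      h (inj₂ (a , refl)) = subst (inject₁ a ∈_) (sym (lookup-indexInT (blockOf a))) (∈hyperedge⁺ (∈extend⁺ (∈blockOf a)))
    down-adj (inj₂ i) (j , refl) _ = subst (parent j ∈_) (sym (lookup-indexInT j)) (parent∈hyperedge j)

    down-height : ∀ x p q → height (down x p q) < height x
    down-height (inj₁ v) _ ne = h (fromℕ-or-inject₁ v)
      where
      h : ∀ s → height (downV v ne s) < height (inj₁ v)
      h (inj₁ e) = ⊥-elim (ne (cong inj₁ e))
      h (inj₂ (a , refl)) = subst (_< vertexHeight (inject₁ a)) (sym (height-indexInT (blockOf a))) (edgeHeight<vertexHeight a)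
    down-height (inj₂ i) (j , refl) _ = subst (vertexHeight (parent j) <_) (sym (height-indexInT j)) (vertexHeight-parent< j)

    height-root : height root ≡ 0
    height-root = vertexHeight-special

    _≟ₙ_ : (x y : Nd) → Dec (x ≡ y)
    _≟ₙ_ = ≡-dec FP._≟_ FP._≟_

    -- Any other hyperedge of T would close a cycle, since two of its vertices are already joined by a
    -- simple path through the hyperedges of the blocks.
    module ExtraHyperedge (iz : Fin (length T)) (bad : ∀ j → lookup T iz ≢ hyperedge j) where
      z : Nd
      z = inj₂ iz

      Good : Nd → Set
      Good w = w ≢ z

      down-good : ∀ x p q → Good (down x p q)
      down-good (inj₁ v) _ ne = h (fromℕ-or-inject₁ v)
        where
        h : ∀ s → Good (downV v ne s)
        h (inj₁ e) = ⊥-elim (ne (cong inj₁ e))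
        h (inj₂ (a , _)) e = bad (blockOf a) (trans (cong (lookup T) (sym (inj₂-injective e))) (lookup-indexInT (blockOf a)))
      down-good (inj₂ i) (j , _) _ ()

      open RootedPaths Adj-sym _≟ₙ_ height In root height-root down down-In down-adj down-height Good down-good

      impossible : ⊥e
      impossible with ∣p∣≥2⇒two-elements (lookup T iz) (subst (2 ≤_) (sym sz) (s≤s (s≤s z≤n)))
        where
        sz : ∣ lookup T iz ∣ ≡ suc (suc r′)
        sz = All.lookup (proj₁ (proj₂ tr)) (LMP.∈-lookup iz)
      ... | (x , y , xe , ye , x≢y)
        with simplePath (suc (height (inj₁ x) + height (inj₁ y))) (inj₁ x) (inj₁ y) tt tt (λ ()) (λ ()) ℕP.≤-refl
      ... | (ps , one , u , g , _) = x≢y refl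
      ... | (.(inj₁ x) ∷ ps′ , step h wk , u , g , _) = closeCycle ps′ h wk u g
        where
        closeCycle : ∀ ps′ {y′} → A (inj₁ x) y′ → Walk y′ (inj₁ y) ps′ → Unique (inj₁ x ∷ ps′) →
                     All Good (inj₁ x ∷ ps′) → ⊥e
        closeCycle [] h () u g
        closeCycle (w ∷ ws) h wk′ u g = proj₂ (proj₂ (proj₂ tr)) (z ∷ inj₁ x ∷ w ∷ ws)
            (isCycle⁺ w ws (All.map (λ gw e → gw (sym e)) g AllPairs.∷ u) (xe Linked.∷ walk-linked (step h wk′))
              (subst (λ t → A t z) (sym (walk-last (step h wk′))) ye))

    every-hyperedge : ∀ i → ∃ λ j → lookup T i ≡ hyperedge j
    every-hyperedge i with FP.any? (λ j → lookup T i ≟ₛ hyperedge j)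
    ... | yes p = p
    ... | no np = ⊥-elim (ExtraHyperedge.impossible i (λ j e → np (j , e)))

    T↭hyperedges : T ↭ hyperedges
    T↭hyperedges = Unique-sameElements⇒↭ (proj₁ tr) hyperedges-unique f g
      where
      f : ∀ e → e ∈L T → e ∈L hyperedges
      f e h = let (j , q) = every-hyperedge (Any.index h) in subst (_∈L hyperedges) (sym (trans (AnyP.lookup-index h) q)) (LMP.∈-tabulate⁺ j)
      g : ∀ e → e ∈L hyperedges → e ∈L T
      g e h = let (j , q) = LMP.∈-tabulate⁻ h in subst (_∈L T) (sym q) (hyperedge∈T j)

    length-T : length T ≡ K
    length-T = trans (↭-length T↭hyperedges) length-hyperedges

    roundOf≤K : ∀ j → roundOf j ≤ K
    roundOf≤K j = subst (roundOf j ≤_) length-T (roundOf≤L j)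


  -- By induction on d: were the hyperedge of block j in the second family that of a block j′ ≠ j, block j′
  -- would hang on block j there while block j hangs on block j′ here.
  hyperedges-determine-parent : ∀ parent d dec parent′ d′ dec′ →
                                (∀ e → e ∈L Hyperedges.hyperedges parent d dec → e ∈L Hyperedges.hyperedges parent′ d′ dec′) →
                                ∀ j → parent j ≡ parent′ j
  hyperedges-determine-parent parent d dec parent′ d′ dec′ sub j = byHeight (suc (d j)) j ℕP.≤-refl
    where
    module H = Hyperedges parent d dec
    module H′ = Hyperedges parent′ d′ dec′
    byHeight : ∀ f j → d j < f → parent j ≡ parent′ j
    byHeight (suc f) j lt with LMP.∈-tabulate⁻ (sub (H.hyperedge j) (LMP.∈-tabulate⁺ j))
    ... | (j′ , q) with j′ FP.≟ j
    ... | yes refl with H′.∈hyperedge⁻ (subst (parent j ∈_) q (H.parent∈hyperedge j))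
    ...   | inj₁ a = ⊥-elim (H.parent∉block j a)
    ...   | inj₂ e = e
    byHeight (suc f) j lt | (j′ , q) | no ne with H′.∈hyperedge⁻ (subst (inject₁ (element j zero) ∈_) q (H.∈hyperedge⁺ (∈extend⁺ (element∈block j zero))))
                                        | H.∈hyperedge⁻ (subst (inject₁ (element j′ zero) ∈_) (sym q) (H′.∈hyperedge⁺ (∈extend⁺ (element∈block j′ zero))))
    ... | inj₁ a | _ = ⊥-elim (ne (trans (blockOf-unique (∈extend⁻ a)) (blockOf-element j zero)))
    ... | inj₂ _ | inj₁ a = ⊥-elim (ne (trans (sym (blockOf-element j′ zero)) (sym (blockOf-unique (∈extend⁻ a)))))
    ... | inj₂ eA | inj₂ eB = ⊥-elim (ℕP.<-asym dj′<dj dj<dj′)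
      where
      dj′<dj : d j′ < d j
      dj′<dj = subst (λ z → d z < d j) (blockOf-element j′ zero) (dec j (element j′ zero) (sym eB))
      ih : parent j′ ≡ parent′ j′
      ih = byHeight f j′ (ℕP.<-≤-trans dj′<dj (ℕ.s≤s⁻¹ lt))
      dj<dj′ : d j < d j′
      dj<dj′ = subst (λ z → d z < d j′) (blockOf-element j zero) (dec j′ (element j zero) (trans ih (sym eA)))


module Correspondence (r′ k : ℕ) (M : List (Subset (suc r′ * k))) (pm : IsPerfectMatching (suc r′) (suc r′ * k) M) where

  open import Data.Nat using (_<_)
  open import Data.Fin using (Fin; fromℕ; inject₁)
  open import Data.Fin.Subset using (_∪_; ⁅_⁆)
  open import Data.List using (lookup)
  open import Data.List.Properties using (tabulate-cong)
  open import Data.List.Relation.Binary.Permutation.Propositional using (_↭_; ↭-sym; ↭-trans)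
  open import Data.List.Relation.Binary.Permutation.Propositional.Properties using (∈-resp-↭)
  open import Data.Product using (_,_; proj₁; proj₂)
  open import Relation.Binary.PropositionalEquality
  open import Defs
  open Subsets using (extend)
  open ParkingCount using (parking⇒countCondition; countCondition⇒parking)

  m = suc r′ * k
  open TreeOfParents r′ m M pm
  open ParentsOfTree r′ m M pm
  module P = ParentsAndParking r′ K
  open P using (Parents; HasHeight; toParking; toParking-cong; toParking-countCondition; fromParking)

  Tree = TreeFrom (suc r′) k M

  module OfTree (x : Tree) where

    open FromTree (proj₁ x) (proj₁ (proj₂ x)) (proj₂ (proj₂ x)) public
      using (parent; roundOf; height-decreasing; T↭hyperedges)

    parents : Parents
    parents j = address (parent j)

    parents-hasHeight : HasHeight parents
    parents-hasHeight = roundOf , ParentsOfTree.FromTree.roundOf≤K r′ m M pm (proj₁ x) (proj₁ (proj₂ x)) (proj₂ (proj₂ x)) ,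
                        λ j j′ i eq → subst (λ b → roundOf b < roundOf j) (blockOf-element j′ i)
                                        (height-decreasing j (element j′ i) (trans (sym (vertex-address (parent j))) (cong vertex eq)))

  module OfParking (a : Park (suc r′) K) where

    private
      cc = parking⇒countCondition (suc r′) K (proj₁ a) (proj₂ a)
      hh = P.FromParking.fromParking-hasHeight (proj₁ a) cc
      level = P.depth (fromParking (proj₁ a))

    parent : Fin K → Fin (suc m)
    parent j = vertex (fromParking (proj₁ a) j)

    address-parent : ∀ j → address (parent j) ≡ fromParking (proj₁ a) j
    address-parent j = address-vertex (fromParking (proj₁ a) j)

    level-special : ∀ j → parent j ≡ fromℕ m → level j ≡ 0
    level-special j eq = proj₁ (P.depth-isDepth hh) j (trans (sym (address-parent j)) (trans (cong address eq) address-fromℕ))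

    level-child : ∀ j a → parent j ≡ inject₁ a → level j ≡ suc (level (blockOf a))
    level-child j a eq = proj₂ (P.depth-isDepth hh) j (blockOf a) (position a)
                           (trans (sym (address-parent j)) (trans (cong address eq) (address-inject₁ a)))

    open SpanningTree parent level (P.depth≤K hh) level-special level-child public
      using (hyperedges; hyperedges-spanningTree; μ-hyperedges; height-decreasing)

    tree : Tree
    tree = hyperedges , hyperedges-spanningTree , μ-hyperedges

  parent-unique : ∀ x parent′ h′ (dec′ : ∀ j a → parent′ j ≡ inject₁ a → h′ (blockOf a) < h′ j) →
                  proj₁ x ↭ Hyperedges.hyperedges parent′ h′ dec′ → ∀ j → OfTree.parent x j ≡ parent′ j
  parent-unique x parent′ h′ dec′ x↭ =
    hyperedges-determine-parent X.parent X.roundOf X.height-decreasing parent′ h′ dec′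
      (λ e e∈ → ∈-resp-↭ x↭ (∈-resp-↭ (↭-sym X.T↭hyperedges) e∈))
    where module X = OfTree x

  toPark : Tree → Park (suc r′) K
  toPark x = toParking parents , countCondition⇒parking (suc r′) K (toParking parents) (toParking-countCondition parents-hasHeight)
    where open OfTree x

  toPark-cong : ∀ x y → proj₁ x ↭ proj₁ y → proj₁ (toPark x) ≡ proj₁ (toPark y)
  toPark-cong x y x↭y = toParking-cong λ j →
    cong address (parent-unique x Y.parent Y.roundOf Y.height-decreasing (↭-trans x↭y Y.T↭hyperedges) j)
    where module Y = OfTree y

  toPark-injective : ∀ x y → proj₁ (toPark x) ≡ proj₁ (toPark y) → proj₁ x ↭ proj₁ y
  toPark-injective x y same = ↭-trans X.T↭hyperedges (subst (_↭ proj₁ y) (sym same-hyperedges) (↭-sym Y.T↭hyperedges))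
    where
    module X = OfTree x
    module Y = OfTree y
    same-parents : ∀ j → X.parents j ≡ Y.parents j
    same-parents j = trans (sym (P.ToParking.fromParking-toParking X.parents X.parents-hasHeight j))
                           (trans (cong (λ v → fromParking v j) same) (P.ToParking.fromParking-toParking Y.parents Y.parents-hasHeight j))
    same-parent : ∀ j → X.parent j ≡ Y.parent j
    same-parent j = trans (sym (vertex-address (X.parent j))) (trans (cong vertex (same-parents j)) (vertex-address (Y.parent j)))
    same-hyperedges : Hyperedges.hyperedges X.parent X.roundOf X.height-decreasing ≡ Hyperedges.hyperedges Y.parent Y.roundOf Y.height-decreasing
    same-hyperedges = tabulate-cong λ j → cong (λ v → extend (lookup M j) ∪ ⁅ v ⁆) (same-parent j)

  toPark-surjective : ∀ a x → proj₁ x ↭ proj₁ (OfParking.tree a) → proj₁ (toPark x) ≡ proj₁ a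
  toPark-surjective a x x↭ = trans (toParking-cong λ j → trans (cong address (parent-unique x T.parent _ T.height-decreasing x↭ j))
                                                                (T.address-parent j))
                                   (P.FromParking.toParking-fromParking (proj₁ a) (parking⇒countCondition (suc r′) K (proj₁ a) (proj₂ a)))
    where module T = OfParking a

  bijection : Bijection (TreeFromSetoid (suc r′) k M) (ParkSetoid (suc r′) K)
  bijection = record
    { to        = toPark
    ; cong      = λ {x} {y} → toPark-cong x y
    ; bijective = (λ {x} {y} → toPark-injective x y) , λ a → OfParking.tree a , λ {x} → toPark-surjective a x
    }


theorem3 : (r k : ℕ) → 1 ≤ r → 1 ≤ k →
           (M : List (Subset (r * k))) → IsPerfectMatching r (r * k) M →
           Bijection (TreeFromSetoid r k M) (ParkSetoid r k)
theorem3 (suc r′) k _ _ M pm =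
  subst (λ K → Bijection (TreeFromSetoid (suc r′) k M) (ParkSetoid (suc r′) K)) K≡k (Correspondence.bijection r′ k M pm)
  where
  K≡k : length M ≡ k
  K≡k = *-cancelˡ-≡ (length M) k (suc r′) (Blocks.R*K≡m (suc r′) (suc r′ * k) M pm)
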